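{- For $n\in\mathbb N$ let $R_n(x)=\sum_{k=0}^n\binom nk\binom{n+k}k\frac{x^k}{2k-1}$ and $R_n=R_n(1)$. (i) For any odd prime $p$, $$\sum_{k=0}^{p-1}R_k\equiv-p-\left(\frac{ -1}p\right)\pmod{p^2}.$$ (ii) For any positive integer $n$, $R_n(-1)=-(2n+1)$, and $$\sum_{k=0}^n\frac{\binom nk\binom{ -n}k}{2k-1}=-2n.$$
   Context: $\left(\frac{\cdot}{p}\right)$ is the Legendre symbol. For an integer $m$ and $k\in\mathbb N$, $\binom mk=m(m-1)\cdots(m-k+1)/k!$ (so negative upper arguments are allowed). $R_n(x)\in\mathbb Z[x]$ since $(2k-1)\mid\binom{2k}k$. -}

module Defs where

open import Data.Nat as ℕ using (ℕ; zero; suc)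
open import Data.Nat.Combinatorics using (_C_)
open import Data.Nat.Properties using (_!≢0)
open import Data.Integer as ℤ using (ℤ; +_)
open import Data.Integer.Divisibility using () renaming (_∣_ to _∣ℤ_)
open import Data.Rational as ℚ using (ℚ)
open import Data.Product using (∃; _×_)
open import Relation.Nullary using (¬_)

sumTo : ℕ → (ℕ → ℚ) → ℚ
sumTo zero    f = f 0
sumTo (suc n) f = sumTo n f ℚ.+ f (suc n)

-- q / (2k - 1) for k : ℕ  (2k-1 = -1 when k = 0)
divOdd : ℚ → ℕ → ℚ
divOdd q zero    = ℚ.- q
divOdd q (suc j) = q ℚ.* (+ 1 ℚ./ suc (2 ℕ.* j))

powℚ : ℚ → ℕ → ℚ
powℚ x zero    = ℚ.1ℚ
powℚ x (suc k) = x ℚ.* powℚ x k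

R : ℕ → ℚ → ℚ
R n x = sumTo n (λ k → divOdd (((+ ((n C k) ℕ.* ((n ℕ.+ k) C k))) ℚ./ 1) ℚ.* powℚ x k) k)

falling : ℤ → ℕ → ℤ
falling m zero    = + 1
falling m (suc k) = falling m k ℤ.* (m ℤ.- + k)

binomℤ : ℤ → ℕ → ℚ
binomℤ m k = ℚ._/_ (falling m k) (k ℕ.!) {{k !≢0}}

data Legendre (a : ℤ) (p : ℕ) : ℤ → Set where
  leg0  : (+ p) ∣ℤ a → Legendre a p (+ 0)
  leg1  : ¬ ((+ p) ∣ℤ a) → ∃ (λ x → (+ p) ∣ℤ (x ℤ.* x ℤ.- a)) → Legendre a p (+ 1)
  leg-1 : ¬ ((+ p) ∣ℤ a) → ¬ ∃ (λ x → (+ p) ∣ℤ (x ℤ.* x ℤ.- a)) → Legendre a p (ℤ.- + 1)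

module Submission where

-- Theorem 1.3.  Put c k = C(2k,k)/(2k-1), an integer (c 0 = -1 and
-- c (k+1) = 2 Cat k).  Trinomial revision C(n,k) C(n+k,k) = C(2k,k) C(n+k,2k)
-- turns R n x into Σ_k c k C(n+k,2k) x^k, so every claim becomes an identity
-- or congruence between integers, transported to ℚ along ι : ℤ → ℚ
-- (sections Embedding to RationalForms).
--
-- (ii) The integer R n (-1) = Σ_k (-1)^k c k C(n+k,2k) has vanishing second
--   difference in n: that difference is -2 Σ_j (-1)^j Cat j C(n+1+j,2j), whose
--   partial sums have a closed form vanishing at the last index; hence
--   R n (-1) = -(2n+1) (PartIIa).  For n = m+1 the k-th term of the second sum
--   is half the sum of the k-th terms of R (m+1) (-1) and R m (-1), giving -2n
--   (PartIIb).
-- (i) Exchanging sums and the hockey stick identity give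
--   Σ_{n<p} R n 1 = Σ_{k<p} T k with T k = c k C(p+k,2k+1).  Since
--   (4k²-1) T k (k!)² = p Π_{j≤k} (p²-j²) ≡ p (-1)^k (k!)² (mod p³), the terms
--   k and p-k cancel mod p², except T 0 = -p and the middle pair h, h+1 (for
--   p = 2h+1), which contributes -(-1)^h (PartI).  Finally (-1/p) = (-1)^h by
--   Fermat's and Wilson's theorems, both derived from the binomial theorem and
--   finite differences of x^n (FermatWilson).

open import Defs
open import Data.Nat as ℕ using (ℕ; suc; _∸_; _<_)
open import Data.Nat.Primality using (Prime)
open import Data.Integer as ℤ using (ℤ; +_)
open import Data.Rational as ℚ using (ℚ)
open import Data.Product using (∃; _×_; _,_)
open import Relation.Binary.PropositionalEquality using (_≡_)

module Embedding where
  open import Data.Nat as ℕ using (ℕ; suc)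
  open import Data.Integer as ℤ using (ℤ; +_)
  open import Data.Rational as ℚ using (ℚ)
  import Data.Rational.Properties as ℚP
  import Data.Rational.Unnormalised as U
  import Data.Rational.Unnormalised.Properties as UP
  open import Data.Empty using (⊥-elim)
  open import Data.Integer.Tactic.RingSolver using (solve-∀)
  open import Relation.Binary.PropositionalEquality

  -- Every identity of the theorem is an
  -- identity between integers transported along ι, so ι must commute with
  -- the ring operations; each law is checked on unnormalised representatives.
  ι : ℤ → ℚ
  ι a = a ℚ./ 1

  private
    toℚᵘ-/ : ∀ a d → ℚ.toℚᵘ (a ℚ./ suc d) U.≃ U.mkℚᵘ a d
    toℚᵘ-/ a d = ℚP.toℚᵘ-fromℚᵘ (U.mkℚᵘ a d)

    toℚᵘ-ι : ∀ a → ℚ.toℚᵘ (ι a) U.≃ U.mkℚᵘ a 0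
    toℚᵘ-ι a = toℚᵘ-/ a 0

  ι-+ : ∀ a b → ι a ℚ.+ ι b ≡ ι (a ℤ.+ b)
  ι-+ a b = ℚP.toℚᵘ-injective (UP.≃-trans (ℚP.toℚᵘ-homo-+ (ι a) (ι b))
    (UP.≃-trans (UP.+-cong (toℚᵘ-ι a) (toℚᵘ-ι b))
    (UP.≃-trans (U.*≡* (cross a b)) (UP.≃-sym (toℚᵘ-ι (a ℤ.+ b))))))
    where
    cross : ∀ a b → (a ℤ.* + 1 ℤ.+ b ℤ.* + 1) ℤ.* + 1 ≡ (a ℤ.+ b) ℤ.* (+ 1 ℤ.* + 1)
    cross = solve-∀

  ι-* : ∀ a b → ι a ℚ.* ι b ≡ ι (a ℤ.* b)
  ι-* a b = ℚP.toℚᵘ-injective (UP.≃-trans (ℚP.toℚᵘ-homo-* (ι a) (ι b))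
    (UP.≃-trans (UP.*-cong (toℚᵘ-ι a) (toℚᵘ-ι b))
    (UP.≃-trans (U.*≡* (cross a b)) (UP.≃-sym (toℚᵘ-ι (a ℤ.* b))))))
    where
    cross : ∀ a b → (a ℤ.* b) ℤ.* (+ 1 ℤ.* + 1) ≡ (a ℤ.* b) ℤ.* + 1
    cross = solve-∀

  ι-neg : ∀ a → ℚ.- ι a ≡ ι (ℤ.- a)
  ι-neg a = ℚP.toℚᵘ-injective (UP.≃-trans (ℚP.toℚᵘ-homo‿- (ι a))
    (UP.≃-trans (UP.-‿cong (toℚᵘ-ι a)) (UP.≃-sym (toℚᵘ-ι (ℤ.- a)))))

  ι-*-1/ : ∀ b d → ι (b ℤ.* + suc d) ℚ.* (+ 1 ℚ./ suc d) ≡ ι b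
  ι-*-1/ b d = ℚP.toℚᵘ-injective (UP.≃-trans (ℚP.toℚᵘ-homo-* (ι (b ℤ.* + suc d)) (+ 1 ℚ./ suc d))
    (UP.≃-trans (UP.*-cong (toℚᵘ-ι (b ℤ.* + suc d)) (toℚᵘ-/ (+ 1) d))
    (UP.≃-trans (U.*≡* (cross b (+ suc d))) (UP.≃-sym (toℚᵘ-ι b)))))
    where
    cross : ∀ b d → (b ℤ.* d ℤ.* + 1) ℤ.* + 1 ≡ b ℤ.* (+ 1 ℤ.* d)
    cross = solve-∀

  /-cancel : ∀ a d .{{_ : ℕ.NonZero d}} → (a ℤ.* + d) ℚ./ d ≡ ι a
  /-cancel a 0 = ⊥-elim (ℕ.≢-nonZero⁻¹ 0 refl)
  /-cancel a (suc d) = ℚP.toℚᵘ-injective (UP.≃-trans (toℚᵘ-/ (a ℤ.* + suc d) d)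
    (UP.≃-trans (U.*≡* (cross a (+ suc d))) (UP.≃-sym (toℚᵘ-ι a))))
    where
    cross : ∀ a d → (a ℤ.* d) ℤ.* + 1 ≡ a ℤ.* d
    cross = solve-∀

module Choose where
  open import Data.Nat using (ℕ; zero; suc; _+_; _*_; _<_; _∸_; z≤n; s≤s; _!; NonZero)
  open import Data.Nat.Properties
  open import Data.Nat.Combinatorics using (_C_; nCk+nC[k+1]≡[n+1]C[k+1]; k>n⇒nCk≡0)
  open import Data.Nat.Tactic.RingSolver using (solve-∀)
  open import Data.Sum using (inj₁; inj₂)
  open import Relation.Binary.PropositionalEquality

  -- Binomial coefficients defined by Pascal's rule, so that the recursion
  -- computes; `choose≡C` identifies them with the library's n C k.
  choose : ℕ → ℕ → ℕ
  choose n zero = 1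
  choose zero (suc k) = 0
  choose (suc n) (suc k) = choose n k + choose n (suc k)

  choose≡C : ∀ n k → choose n k ≡ n C k
  choose≡C zero zero = refl
  choose≡C (suc n) zero = refl
  choose≡C zero (suc k) = sym (k>n⇒nCk≡0 {0} {suc k} (s≤s z≤n))
  choose≡C (suc n) (suc k) =
    trans (cong₂ _+_ (choose≡C n k) (choose≡C n (suc k))) (nCk+nC[k+1]≡[n+1]C[k+1] n k)

  choose-vanish : ∀ n k → n < k → choose n k ≡ 0
  choose-vanish zero (suc k) _ = refl
  choose-vanish (suc n) (suc k) (s≤s n<k) =
    cong₂ _+_ (choose-vanish n k n<k) (choose-vanish n (suc k) (m<n⇒m<1+n n<k))

  choose-diag : ∀ n → choose n n ≡ 1
  choose-diag zero = refl
  choose-diag (suc n) = cong₂ _+_ (choose-diag n) (choose-vanish n (suc n) (n<1+n n))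

  choose-absorb : ∀ n k → suc k * choose (suc n) (suc k) ≡ suc n * choose n k
  choose-absorb zero zero = refl
  choose-absorb zero (suc k) = *-zeroʳ (suc (suc k))
  choose-absorb (suc n) zero = trans (*-identityˡ _) (trans (cong suc choose-n-1) (sym (*-identityʳ _)))
    where
    choose-n-1 : choose (suc n) 1 ≡ suc n
    choose-n-1 = trans (sym (*-identityˡ _)) (trans (choose-absorb n 0) (*-identityʳ _))
  choose-absorb (suc n) (suc k) = begin
    suc (suc k) * (choose (suc n) (suc k) + choose (suc n) (suc (suc k)))
      ≡⟨ split (suc k) (choose (suc n) (suc k)) (choose (suc n) (suc (suc k))) ⟩
    suc k * choose (suc n) (suc k) + choose (suc n) (suc k) + suc (suc k) * choose (suc n) (suc (suc k))
      ≡⟨ cong₂ (λ x y → x + choose (suc n) (suc k) + y) (choose-absorb n k) (choose-absorb n (suc k)) ⟩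
    suc n * choose n k + choose (suc n) (suc k) + suc n * choose n (suc k)
      ≡⟨ merge (suc n) (choose n k) (choose n (suc k)) ⟩
    suc (suc n) * (choose n k + choose n (suc k)) ∎
    where
    open ≡-Reasoning
    split : ∀ k x y → suc k * (x + y) ≡ k * x + x + suc k * y
    split = solve-∀
    merge : ∀ m a b → m * a + (a + b) + m * b ≡ suc m * (a + b)
    merge = solve-∀

  choose-factorial : ∀ n k → choose (n + k) k * (k ! * n !) ≡ (n + k) !
  choose-factorial n zero = trans (*-identityˡ _) (trans (*-identityˡ _) (cong _! (sym (+-identityʳ n))))
  choose-factorial n (suc k) = begin
    choose (n + suc k) (suc k) * (suc k ! * n !)
      ≡⟨ cong (λ z → choose z (suc k) * (suc k ! * n !)) (+-suc n k) ⟩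
    choose (suc (n + k)) (suc k) * ((suc k * k !) * n !)
      ≡⟨ regroup (choose (suc (n + k)) (suc k)) (suc k) (k !) (n !) ⟩
    (suc k * choose (suc (n + k)) (suc k)) * (k ! * n !)
      ≡⟨ cong (_* (k ! * n !)) (choose-absorb (n + k) k) ⟩
    (suc (n + k) * choose (n + k) k) * (k ! * n !)
      ≡⟨ *-assoc (suc (n + k)) (choose (n + k) k) (k ! * n !) ⟩
    suc (n + k) * (choose (n + k) k * (k ! * n !))
      ≡⟨ cong (suc (n + k) *_) (choose-factorial n k) ⟩
    suc (n + k) !
      ≡⟨ cong _! (sym (+-suc n k)) ⟩
    (n + suc k) ! ∎
    where
    open ≡-Reasoning
    regroup : ∀ b s kf nf → b * ((s * kf) * nf) ≡ (s * b) * (kf * nf)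
    regroup = solve-∀

  -- Trinomial revision  C(n,k) C(n+k,k) = C(2k,k) C(n+k,2k).  For n = r + k
  -- both sides times k!² r! equal (n+k)!, by `choose-factorial`.
  private
    trinomial-revision-shifted : ∀ r k →
      choose (r + k) k * choose ((r + k) + k) k ≡ choose (k + k) k * choose ((r + k) + k) (k + k)
    trinomial-revision-shifted r k = *-cancelʳ-≡ lhs rhs denom {{denom≢0}} (trans lhs-denom (sym rhs-denom))
      where
      open ≡-Reasoning
      instance
        _ = k !≢0
        _ = r !≢0
        _ = (r + k) !≢0
        _ = (k + k) !≢0
      N = ((r + k) + k) !
      lhs = choose (r + k) k * choose ((r + k) + k) k
      rhs = choose (k + k) k * choose ((r + k) + k) (k + k)
      denom = (k ! * k !) * r !
      denom≢0 : NonZero denom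
      denom≢0 = m*n≢0 (k ! * k !) (r !) {{m*n≢0 (k !) (k !)}}
      choose-2k : choose ((r + k) + k) (k + k) * ((k + k) ! * r !) ≡ N
      choose-2k = subst (λ z → choose z (k + k) * ((k + k) ! * r !) ≡ z !) (sym (+-assoc r k k))
                        (choose-factorial r (k + k))
      lhs-denom : lhs * denom ≡ N
      lhs-denom = *-cancelʳ-≡ (lhs * denom) N ((r + k) !) (begin
        lhs * denom * (r + k) !
          ≡⟨ regroup (choose (r + k) k) (choose ((r + k) + k) k) (k !) (r !) ((r + k) !) ⟩
        (choose (r + k) k * (k ! * r !)) * (choose ((r + k) + k) k * (k ! * (r + k) !))
          ≡⟨ cong₂ _*_ (choose-factorial r k) (choose-factorial (r + k) k) ⟩
        (r + k) ! * N
          ≡⟨ *-comm ((r + k) !) N ⟩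
        N * (r + k) ! ∎)
        where
        regroup : ∀ a c kf rf rkf → a * c * ((kf * kf) * rf) * rkf ≡ (a * (kf * rf)) * (c * (kf * rkf))
        regroup = solve-∀
      rhs-denom : rhs * denom ≡ N
      rhs-denom = *-cancelʳ-≡ (rhs * denom) N ((k + k) !) (begin
        rhs * denom * (k + k) !
          ≡⟨ regroup (choose (k + k) k) (choose ((r + k) + k) (k + k)) (k !) (r !) ((k + k) !) ⟩
        (choose (k + k) k * (k ! * k !)) * (choose ((r + k) + k) (k + k) * ((k + k) ! * r !))
          ≡⟨ cong₂ _*_ (choose-factorial k k) choose-2k ⟩
        (k + k) ! * N
          ≡⟨ *-comm ((k + k) !) N ⟩
        N * (k + k) ! ∎)
        where
        regroup : ∀ a c kf rf kkf → a * c * ((kf * kf) * rf) * kkf ≡ (a * (kf * kf)) * (c * (kkf * rf))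
        regroup = solve-∀

  -- For n < k both sides vanish.
  trinomial-revision : ∀ n k → choose n k * choose (n + k) k ≡ choose (k + k) k * choose (n + k) (k + k)
  trinomial-revision n k with ≤-<-connex k n
  ... | inj₁ k≤n =
    subst (λ z → choose z k * choose (z + k) k ≡ choose (k + k) k * choose (z + k) (k + k))
          (m∸n+n≡m k≤n) (trinomial-revision-shifted (n ∸ k) k)
  ... | inj₂ n<k = begin
    choose n k * choose (n + k) k     ≡⟨ cong (_* choose (n + k) k) (choose-vanish n k n<k) ⟩
    0                                 ≡⟨ sym (*-zeroʳ (choose (k + k) k)) ⟩
    choose (k + k) k * 0              ≡⟨ cong (choose (k + k) k *_) (sym (choose-vanish (n + k) (k + k) (+-monoˡ-< k n<k))) ⟩
    choose (k + k) k * choose (n + k) (k + k) ∎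
    where open ≡-Reasoning

module BinomialZ where
  open import Data.Nat as ℕ using (ℕ; zero; suc)
  open import Data.Integer using (ℤ; +_; _+_; _*_; _-_)
  import Data.Integer.Properties as ℤP
  open import Data.Integer.Tactic.RingSolver using (solve-∀)
  open import Relation.Binary.PropositionalEquality
  open Choose

  C : ℕ → ℕ → ℤ
  C n k = + choose n k

  C-pascal : ∀ n k → C (suc n) (suc k) ≡ C n k + C n (suc k)
  C-pascal n k = ℤP.pos-+ (choose n k) (choose n (suc k))

  C-absorb : ∀ n k → (+ 1 + + k) * C (suc n) (suc k) ≡ (+ 1 + + n) * C n k
  C-absorb n k = trans (sym (ℤP.pos-* (suc k) _)) (trans (cong +_ (choose-absorb n k)) (ℤP.pos-* (suc n) _))

  C-absorb-lower : ∀ n k → (+ 1 + + k) * C n (suc k) ≡ (+ n - + k) * C n k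
  C-absorb-lower n k = begin
    (+ 1 + + k) * C n (suc k)                               ≡⟨ expand (+ k) (C n (suc k)) (C n k) ⟩
    (+ 1 + + k) * (C n k + C n (suc k)) - (+ 1 + + k) * C n k ≡⟨ cong (λ z → (+ 1 + + k) * z - (+ 1 + + k) * C n k) (sym (C-pascal n k)) ⟩
    (+ 1 + + k) * C (suc n) (suc k) - (+ 1 + + k) * C n k    ≡⟨ cong (_- (+ 1 + + k) * C n k) (C-absorb n k) ⟩
    (+ 1 + + n) * C n k - (+ 1 + + k) * C n k                ≡⟨ collect (+ k) (+ n) (C n k) ⟩
    (+ n - + k) * C n k ∎
    where
    open ≡-Reasoning
    expand : ∀ K X Y → (+ 1 + K) * X ≡ (+ 1 + K) * (Y + X) - (+ 1 + K) * Y
    expand = solve-∀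
    collect : ∀ K N Y → (+ 1 + N) * Y - (+ 1 + K) * Y ≡ (N - K) * Y
    collect = solve-∀

  C-absorb-twice : ∀ a j → (+ 2 + + j) * (+ 1 + + j) * C (suc a) (suc (suc j)) ≡ (+ 1 + + a) * (+ a - + j) * C a j
  C-absorb-twice a j = begin
    (+ 2 + + j) * (+ 1 + + j) * C (suc a) (suc (suc j)) ≡⟨ reassoc (+ j) (C (suc a) (suc (suc j))) ⟩
    (+ 1 + + j) * ((+ 1 + + suc j) * C (suc a) (suc (suc j))) ≡⟨ cong ((+ 1 + + j) *_) (C-absorb a (suc j)) ⟩
    (+ 1 + + j) * ((+ 1 + + a) * C a (suc j)) ≡⟨ swap (+ j) (+ a) (C a (suc j)) ⟩
    (+ 1 + + a) * ((+ 1 + + j) * C a (suc j)) ≡⟨ cong ((+ 1 + + a) *_) (C-absorb-lower a j) ⟩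
    (+ 1 + + a) * ((+ a - + j) * C a j) ≡⟨ sym (ℤP.*-assoc (+ 1 + + a) (+ a - + j) (C a j)) ⟩
    (+ 1 + + a) * (+ a - + j) * C a j ∎
    where
    open ≡-Reasoning
    reassoc : ∀ J X → (+ 2 + J) * (+ 1 + J) * X ≡ (+ 1 + J) * ((+ 1 + (+ 1 + J)) * X)
    reassoc = solve-∀
    swap : ∀ J A X → (+ 1 + J) * ((+ 1 + A) * X) ≡ (+ 1 + A) * ((+ 1 + J) * X)
    swap = solve-∀

  C-n-1 : ∀ n → C n 1 ≡ + n
  C-n-1 zero = refl
  C-n-1 (suc n) = trans (C-pascal n 0) (cong (λ z → + 1 + z) (C-n-1 n))

  C-second-difference : ∀ a m → C (suc (suc a)) (suc (suc m)) - + 2 * C (suc a) (suc (suc m)) + C a (suc (suc m)) ≡ C a m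
  C-second-difference a m = begin
    C (suc (suc a)) (suc (suc m)) - + 2 * C (suc a) (suc (suc m)) + C a (suc (suc m))
      ≡⟨ cong (λ z → z - + 2 * C (suc a) (suc (suc m)) + C a (suc (suc m))) (C-pascal (suc a) (suc m)) ⟩
    C (suc a) (suc m) + C (suc a) (suc (suc m)) - + 2 * C (suc a) (suc (suc m)) + C a (suc (suc m))
      ≡⟨ cong₂ (λ x y → x + y - + 2 * y + C a (suc (suc m))) (C-pascal a m) (C-pascal a (suc m)) ⟩
    C a m + C a (suc m) + (C a (suc m) + C a (suc (suc m))) - + 2 * (C a (suc m) + C a (suc (suc m))) + C a (suc (suc m))
      ≡⟨ cancel (C a m) (C a (suc m)) (C a (suc (suc m))) ⟩
    C a m ∎
    where
    open ≡-Reasoning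
    cancel : ∀ x y z → x + y + (y + z) - + 2 * (y + z) + z ≡ x
    cancel = solve-∀

  C-trinomial-revision : ∀ n k → C n k * C (n ℕ.+ k) k ≡ C (k ℕ.+ k) k * C (n ℕ.+ k) (k ℕ.+ k)
  C-trinomial-revision n k =
    trans (sym (ℤP.pos-* (choose n k) _)) (trans (cong +_ (trinomial-revision n k)) (ℤP.pos-* (choose (k ℕ.+ k) k) _))

module Central where
  open import Data.Nat as ℕ using (ℕ; zero; suc)
  import Data.Nat.Properties as ℕP
  open import Data.Integer using (ℤ; +_; _+_; _*_; -_; _-_)
  import Data.Integer.Properties as ℤP
  open import Data.Integer.Tactic.RingSolver using (solve-∀)
  open import Relation.Binary.PropositionalEquality
  open BinomialZ

  catalan : ℕ → ℤ
  catalan k = C (k ℕ.+ k) k - C (k ℕ.+ k) (suc k)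

  -- The denominator 2k-1 of the theorem, and c k = C(2k,k)/(2k-1), which is
  -- an integer: c 0 = -1 and c (k+1) = 2 Cat k (see `den*c`).
  den : ℕ → ℤ
  den k = + (k ℕ.+ k) - + 1

  c : ℕ → ℤ
  c zero = - + 1
  c (suc k) = + 2 * catalan k

  2[1+k]≡2+2k : ∀ k → suc k ℕ.+ suc k ≡ suc (suc (k ℕ.+ k))
  2[1+k]≡2+2k k = cong suc (ℕP.+-suc k k)

  -- (k+1) Cat k = C(2k,k), by absorption C(2k,k+1) = k/(k+1) C(2k,k).
  catalan-central : ∀ k → (+ 1 + + k) * catalan k ≡ C (k ℕ.+ k) k
  catalan-central k = begin
    (+ 1 + + k) * (X - Y)                       ≡⟨ distrib (+ 1 + + k) X Y ⟩
    (+ 1 + + k) * X - (+ 1 + + k) * Y           ≡⟨ cong (λ z → (+ 1 + + k) * X - z) (C-absorb-lower (k ℕ.+ k) k) ⟩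
    (+ 1 + + k) * X - (+ k + + k - + k) * X     ≡⟨ collect (+ k) X ⟩
    X ∎
    where
    open ≡-Reasoning
    X = C (k ℕ.+ k) k
    Y = C (k ℕ.+ k) (suc k)
    distrib : ∀ a x y → a * (x - y) ≡ a * x - a * y
    distrib = solve-∀
    collect : ∀ k x → (+ 1 + k) * x - (k + k - k) * x ≡ x
    collect = solve-∀

  private
    C-odd-central : ∀ k → (+ 1 + + k) * C (suc (k ℕ.+ k)) k ≡ (+ 1 + (+ k + + k)) * C (k ℕ.+ k) k
    C-odd-central k = begin
      (+ 1 + + k) * C (suc (k ℕ.+ k)) k           ≡⟨ cong (_* C (suc (k ℕ.+ k)) k) (rewrite-coeff (+ k)) ⟩
      (+ suc (k ℕ.+ k) - + k) * C (suc (k ℕ.+ k)) k ≡⟨ sym (C-absorb-lower (suc (k ℕ.+ k)) k) ⟩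
      (+ 1 + + k) * C (suc (k ℕ.+ k)) (suc k)     ≡⟨ C-absorb (k ℕ.+ k) k ⟩
      (+ 1 + (+ k + + k)) * C (k ℕ.+ k) k ∎
      where
      open ≡-Reasoning
      rewrite-coeff : ∀ k → + 1 + k ≡ + 1 + (k + k) - k
      rewrite-coeff = solve-∀

  C-central-succ : ∀ k → C (suc k ℕ.+ suc k) (suc k) ≡ + 2 * (+ 1 + (+ k + + k)) * catalan k
  C-central-succ k = ℤP.*-cancelˡ-≡ (+ 1 + + k) _ _ (begin
    (+ 1 + + k) * C (suc k ℕ.+ suc k) (suc k)       ≡⟨ cong (λ z → (+ 1 + + k) * C z (suc k)) (2[1+k]≡2+2k k) ⟩
    (+ 1 + + k) * C (suc (suc (k ℕ.+ k))) (suc k)   ≡⟨ C-absorb (suc (k ℕ.+ k)) k ⟩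
    (+ 1 + (+ 1 + (+ k + + k))) * C (suc (k ℕ.+ k)) k ≡⟨ factor (+ k) (C (suc (k ℕ.+ k)) k) ⟩
    + 2 * ((+ 1 + + k) * C (suc (k ℕ.+ k)) k)       ≡⟨ cong (+ 2 *_) (C-odd-central k) ⟩
    + 2 * ((+ 1 + (+ k + + k)) * C (k ℕ.+ k) k)     ≡⟨ cong (λ z → + 2 * ((+ 1 + (+ k + + k)) * z)) (sym (catalan-central k)) ⟩
    + 2 * ((+ 1 + (+ k + + k)) * ((+ 1 + + k) * catalan k)) ≡⟨ reorder (+ k) (catalan k) ⟩
    (+ 1 + + k) * (+ 2 * (+ 1 + (+ k + + k)) * catalan k) ∎)
    where
    open ≡-Reasoning
    factor : ∀ k x → (+ 1 + (+ 1 + (k + k))) * x ≡ + 2 * ((+ 1 + k) * x)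
    factor = solve-∀
    reorder : ∀ k x → + 2 * ((+ 1 + (k + k)) * ((+ 1 + k) * x)) ≡ (+ 1 + k) * (+ 2 * (+ 1 + (k + k)) * x)
    reorder = solve-∀

  den*c : ∀ k → den k * c k ≡ C (k ℕ.+ k) k
  den*c zero = refl
  den*c (suc k) = trans (reorder (+ k) (catalan k)) (sym (C-central-succ k))
    where
    reorder : ∀ k x → (+ 1 + k + (+ 1 + k) - + 1) * (+ 2 * x) ≡ + 2 * (+ 1 + (k + k)) * x
    reorder = solve-∀

  catalan-succ : ∀ k → (+ 2 + + k) * catalan (suc k) ≡ + 2 * (+ 1 + (+ k + + k)) * catalan k
  catalan-succ k = trans (catalan-central (suc k)) (C-central-succ k)

module Sums where
  open import Data.Nat as ℕ using (ℕ; zero; suc; _<_; _≤_)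
  import Data.Nat.Properties as ℕP
  open import Data.Integer as ℤ using (ℤ; +_; _+_; _*_; -_)
  import Data.Integer.Properties as ℤP
  open import Data.Integer.Divisibility.Signed using (_∣_; divides; ∣m∣n⇒∣m+n)
  open import Data.Integer.Tactic.RingSolver using (solve-∀)
  open import Data.Rational as ℚ using (ℚ)
  open import Relation.Binary.PropositionalEquality
  open import Defs using (sumTo)
  open Embedding

  Σ< : ℕ → (ℕ → ℤ) → ℤ
  Σ< zero f = + 0
  Σ< (suc n) f = Σ< n f + f n

  Σ<-cong : ∀ n {f g : ℕ → ℤ} → (∀ k → k < n → f k ≡ g k) → Σ< n f ≡ Σ< n g
  Σ<-cong zero eq = refl
  Σ<-cong (suc n) eq = cong₂ _+_ (Σ<-cong n (λ k k<n → eq k (ℕP.m<n⇒m<1+n k<n))) (eq n (ℕP.n<1+n n))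

  Σ<-+ : ∀ n (f g : ℕ → ℤ) → Σ< n (λ k → f k + g k) ≡ Σ< n f + Σ< n g
  Σ<-+ zero f g = refl
  Σ<-+ (suc n) f g = trans (cong (_+ (f n + g n)) (Σ<-+ n f g)) (interchange (Σ< n f) (Σ< n g) (f n) (g n))
    where
    interchange : ∀ a b c d → a + b + (c + d) ≡ a + c + (b + d)
    interchange = solve-∀

  Σ<-* : ∀ n a (f : ℕ → ℤ) → Σ< n (λ k → a * f k) ≡ a * Σ< n f
  Σ<-* zero a f = sym (ℤP.*-zeroʳ a)
  Σ<-* (suc n) a f = trans (cong (_+ a * f n) (Σ<-* n a f)) (sym (ℤP.*-distribˡ-+ a (Σ< n f) (f n)))

  Σ<-neg : ∀ n (f : ℕ → ℤ) → Σ< n (λ k → - f k) ≡ - Σ< n f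
  Σ<-neg zero f = refl
  Σ<-neg (suc n) f = trans (cong (_+ - f n) (Σ<-neg n f)) (sym (ℤP.neg-distrib-+ (Σ< n f) (f n)))

  Σ<-head : ∀ n (f : ℕ → ℤ) → Σ< (suc n) f ≡ f 0 + Σ< n (λ k → f (suc k))
  Σ<-head zero f = ℤP.+-comm (+ 0) (f 0)
  Σ<-head (suc n) f = trans (cong (_+ f (suc n)) (Σ<-head n f)) (ℤP.+-assoc (f 0) _ _)

  Σ<-pad : ∀ n d (f : ℕ → ℤ) → (∀ k → n ≤ k → f k ≡ + 0) → Σ< (d ℕ.+ n) f ≡ Σ< n f
  Σ<-pad n zero f vanish = refl
  Σ<-pad n (suc d) f vanish =
    trans (cong₂ _+_ (Σ<-pad n d f vanish) (vanish (d ℕ.+ n) (ℕP.m≤n+m n d))) (ℤP.+-identityʳ _)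

  Σ<-swap : ∀ m n (F : ℕ → ℕ → ℤ) → Σ< m (λ i → Σ< n (λ j → F i j)) ≡ Σ< n (λ j → Σ< m (λ i → F i j))
  Σ<-swap zero n F = sym (Σ<-zero n)
    where
    Σ<-zero : ∀ n → Σ< n (λ _ → + 0) ≡ + 0
    Σ<-zero zero = refl
    Σ<-zero (suc n) = cong (_+ + 0) (Σ<-zero n)
  Σ<-swap (suc m) n F = trans (cong (_+ Σ< n (λ j → F m j)) (Σ<-swap m n F))
                              (sym (Σ<-+ n (λ j → Σ< m (λ i → F i j)) (λ j → F m j)))

  sumTo-ι : ∀ n (f : ℕ → ℚ) (g : ℕ → ℤ) → (∀ k → f k ≡ ι (g k)) → sumTo n f ≡ ι (Σ< (suc n) g)
  sumTo-ι zero f g eq = trans (eq 0) (cong ι (sym (ℤP.+-identityˡ (g 0))))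
  sumTo-ι (suc n) f g eq = trans (cong₂ ℚ._+_ (sumTo-ι n f g eq) (eq (suc n))) (ι-+ (Σ< (suc n) g) (g (suc n)))

  ∣-Σ< : ∀ m n (f : ℕ → ℤ) → (∀ k → k < n → m ∣ f k) → m ∣ Σ< n f
  ∣-Σ< m zero f _ = divides (+ 0) (sym (ℤP.*-zeroˡ m))
  ∣-Σ< m (suc n) f div = ∣m∣n⇒∣m+n (∣-Σ< m n f (λ k k<n → div k (ℕP.m<n⇒m<1+n k<n))) (div n (ℕP.n<1+n n))

module Sign where
  open import Data.Nat as ℕ using (ℕ; zero; suc)
  open import Data.Integer using (ℤ; +_; _*_; -_; _^_)
  import Data.Integer.Properties as ℤP
  open import Data.Integer.Tactic.RingSolver using (solve-∀)
  open import Data.Sum using (_⊎_; inj₁; inj₂)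
  open import Relation.Binary.PropositionalEquality

  -- sgn k = (-1)^k, by a recursion that exposes the sign change.
  sgn : ℕ → ℤ
  sgn zero = + 1
  sgn (suc k) = - sgn k

  [-1]^≡sgn : ∀ n → (- + 1) ^ n ≡ sgn n
  [-1]^≡sgn zero = refl
  [-1]^≡sgn (suc n) = trans (ℤP.-1*i≡-i ((- + 1) ^ n)) (cong -_ ([-1]^≡sgn n))

  sgn-+ : ∀ a b → sgn (a ℕ.+ b) ≡ sgn a * sgn b
  sgn-+ zero b = sym (ℤP.*-identityˡ (sgn b))
  sgn-+ (suc a) b = trans (cong -_ (sgn-+ a b)) (ℤP.neg-distribˡ-* (sgn a) (sgn b))

  sgn-square : ∀ a → sgn a * sgn a ≡ + 1
  sgn-square zero = refl
  sgn-square (suc a) = trans (neg*neg (sgn a)) (sgn-square a)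
    where
    neg*neg : ∀ s → - s * - s ≡ s * s
    neg*neg = solve-∀

  sgn-even : ∀ h → sgn (h ℕ.+ h) ≡ + 1
  sgn-even h = trans (sgn-+ h h) (sgn-square h)

  sgn-cases : ∀ n → sgn n ≡ + 1 ⊎ sgn n ≡ - + 1
  sgn-cases zero = inj₁ refl
  sgn-cases (suc n) with sgn-cases n
  ... | inj₁ eq = inj₂ (cong -_ eq)
  ... | inj₂ eq = inj₁ (cong -_ eq)

module RationalForms where
  open import Data.Nat as ℕ using (ℕ; zero; suc; _!)
  import Data.Nat.Properties as ℕP
  import Data.Nat.Combinatorics as Comb
  open import Data.Integer using (ℤ; +_; _+_; _*_; -_; _-_; _^_)
  import Data.Integer.Properties as ℤP
  open import Data.Integer.Tactic.RingSolver using (solve-∀)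
  open import Data.Rational as ℚ using (ℚ)
  open import Relation.Binary.PropositionalEquality
  open import Defs
  open Embedding
  open Choose using (choose; choose≡C)
  open BinomialZ
  open Central
  open Sums
  open Sign

  divOdd-ι : ∀ k (y : ℤ) → divOdd (ι (den k * y)) k ≡ ι y
  divOdd-ι zero y = trans (ι-neg (den 0 * y)) (cong ι (neg-neg y))
    where
    neg-neg : ∀ y → - ((+ 0 - + 1) * y) ≡ y
    neg-neg = solve-∀
  divOdd-ι (suc j) y = trans (cong (λ z → ι z ℚ.* (+ 1 ℚ./ suc (2 ℕ.* j))) den-comm) (ι-*-1/ y (2 ℕ.* j))
    where
    den-comm : den (suc j) * y ≡ y * + suc (2 ℕ.* j)
    den-comm = trans (reorder (+ j) y) (cong (λ z → y * (+ 1 + z)) (sym (ℤP.pos-* 2 j)))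
      where
      reorder : ∀ j y → ((+ 1 + j) + (+ 1 + j) - + 1) * y ≡ y * (+ 1 + + 2 * j)
      reorder = solve-∀

  powℚ-ι : ∀ (z : ℤ) k → powℚ (ι z) k ≡ ι (z ^ k)
  powℚ-ι z zero = refl
  powℚ-ι z (suc k) = trans (cong (ι z ℚ.*_) (powℚ-ι z k)) (ι-* z (z ^ k))

  -- The k-th term of R n (ι z) is the integer c k C(n+k,2k) z^k, because
  -- C(n,k) C(n+k,k) = C(2k,k) C(n+k,2k) = (2k-1) c k C(n+k,2k).
  R-term-ι : ∀ n k (z : ℤ) →
    divOdd (((+ ((n Comb.C k) ℕ.* ((n ℕ.+ k) Comb.C k))) ℚ./ 1) ℚ.* powℚ (ι z) k) k ≡ ι (c k * C (n ℕ.+ k) (k ℕ.+ k) * z ^ k)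
  R-term-ι n k z = trans (cong (λ q → divOdd q k) numerator) (divOdd-ι k _)
    where
    coefficient : + ((n Comb.C k) ℕ.* ((n ℕ.+ k) Comb.C k)) ≡ den k * c k * C (n ℕ.+ k) (k ℕ.+ k)
    coefficient = begin
      + ((n Comb.C k) ℕ.* ((n ℕ.+ k) Comb.C k)) ≡⟨ cong₂ (λ x y → + (x ℕ.* y)) (sym (choose≡C n k)) (sym (choose≡C (n ℕ.+ k) k)) ⟩
      + (choose n k ℕ.* choose (n ℕ.+ k) k)   ≡⟨ ℤP.pos-* (choose n k) _ ⟩
      C n k * C (n ℕ.+ k) k                   ≡⟨ C-trinomial-revision n k ⟩
      C (k ℕ.+ k) k * C (n ℕ.+ k) (k ℕ.+ k)   ≡⟨ cong (_* C (n ℕ.+ k) (k ℕ.+ k)) (sym (den*c k)) ⟩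
      den k * c k * C (n ℕ.+ k) (k ℕ.+ k) ∎
      where open ≡-Reasoning
    numerator : ((+ ((n Comb.C k) ℕ.* ((n ℕ.+ k) Comb.C k))) ℚ./ 1) ℚ.* powℚ (ι z) k ≡ ι (den k * (c k * C (n ℕ.+ k) (k ℕ.+ k) * z ^ k))
    numerator = trans (cong₂ ℚ._*_ (cong ι coefficient) (powℚ-ι z k))
                      (trans (ι-* (den k * c k * C (n ℕ.+ k) (k ℕ.+ k)) (z ^ k))
                             (cong ι (reassoc (den k) (c k) (C (n ℕ.+ k) (k ℕ.+ k)) (z ^ k))))
      where
      reassoc : ∀ o c x w → o * c * x * w ≡ o * (c * x * w)
      reassoc = solve-∀

  R-ι : ∀ n (z : ℤ) → R n (ι z) ≡ ι (Σ< (suc n) (λ k → c k * C (n ℕ.+ k) (k ℕ.+ k) * z ^ k))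
  R-ι n z = sumTo-ι n _ _ (λ k → R-term-ι n k z)

  R-at-1 : ∀ n → R n ℚ.1ℚ ≡ ι (Σ< (suc n) (λ k → c k * C (n ℕ.+ k) (k ℕ.+ k)))
  R-at-1 n = trans (R-ι n (+ 1)) (cong ι (Σ<-cong (suc n) (λ k _ → drop-power k)))
    where
    drop-power : ∀ k → c k * C (n ℕ.+ k) (k ℕ.+ k) * (+ 1) ^ k ≡ c k * C (n ℕ.+ k) (k ℕ.+ k)
    drop-power k = trans (cong (c k * C (n ℕ.+ k) (k ℕ.+ k) *_) (ℤP.^-zeroˡ k)) (ℤP.*-identityʳ _)

  R-at-−1 : ∀ n → R n (ℚ.- ℚ.1ℚ) ≡ ι (Σ< (suc n) (λ k → sgn k * c k * C (n ℕ.+ k) (k ℕ.+ k)))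
  R-at-−1 n = trans (cong (R n) (ι-neg (+ 1))) (trans (R-ι n (- + 1)) (cong ι (Σ<-cong (suc n) (λ k _ → sign-first k))))
    where
    sign-first : ∀ k → c k * C (n ℕ.+ k) (k ℕ.+ k) * (- + 1) ^ k ≡ sgn k * c k * C (n ℕ.+ k) (k ℕ.+ k)
    sign-first k = trans (cong (c k * C (n ℕ.+ k) (k ℕ.+ k) *_) ([-1]^≡sgn k)) (reorder (c k) (C (n ℕ.+ k) (k ℕ.+ k)) (sgn k))
      where
      reorder : ∀ a x s → a * x * s ≡ s * a * x
      reorder = solve-∀

  -- Falling factorials of ±n as multiples of k!, so that the generalised
  -- binomial coefficients with upper argument n and -(m+1) are integers.
  falling-pos : ∀ n k → falling (+ n) k ≡ C n k * + (k !)
  falling-pos n zero = refl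
  falling-pos n (suc k) = begin
    falling (+ n) k * (+ n - + k)            ≡⟨ cong (_* (+ n - + k)) (falling-pos n k) ⟩
    C n k * + (k !) * (+ n - + k)            ≡⟨ reorder (C n k) (+ (k !)) (+ n - + k) ⟩
    + (k !) * ((+ n - + k) * C n k)          ≡⟨ cong (+ (k !) *_) (sym (C-absorb-lower n k)) ⟩
    + (k !) * ((+ 1 + + k) * C n (suc k))    ≡⟨ reorder′ (+ (k !)) (+ 1 + + k) (C n (suc k)) ⟩
    C n (suc k) * ((+ 1 + + k) * + (k !))    ≡⟨ cong (C n (suc k) *_) (sym (ℤP.pos-* (suc k) (k !))) ⟩
    C n (suc k) * + (suc k !) ∎
    where
    open ≡-Reasoning
    reorder : ∀ x f d → x * f * d ≡ f * (d * x)
    reorder = solve-∀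
    reorder′ : ∀ f s x → f * (s * x) ≡ x * (s * f)
    reorder′ = solve-∀

  falling-neg : ∀ m k → falling (- + suc m) k ≡ sgn k * C (m ℕ.+ k) k * + (k !)
  falling-neg m zero = refl
  falling-neg m (suc k) = begin
    falling (- + suc m) k * (- + suc m - + k)                   ≡⟨ cong (_* (- + suc m - + k)) (falling-neg m k) ⟩
    sgn k * C (m ℕ.+ k) k * + (k !) * (- + suc m - + k)         ≡⟨ reorder (sgn k) (C (m ℕ.+ k) k) (+ (k !)) (+ m) (+ k) ⟩
    - sgn k * + (k !) * ((+ 1 + (+ m + + k)) * C (m ℕ.+ k) k)   ≡⟨ cong (λ z → - sgn k * + (k !) * z) (sym (C-absorb (m ℕ.+ k) k)) ⟩
    - sgn k * + (k !) * ((+ 1 + + k) * C (suc (m ℕ.+ k)) (suc k)) ≡⟨ cong (λ z → - sgn k * + (k !) * ((+ 1 + + k) * C z (suc k))) (sym (ℕP.+-suc m k)) ⟩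
    - sgn k * + (k !) * ((+ 1 + + k) * C (m ℕ.+ suc k) (suc k)) ≡⟨ reorder′ (sgn k) (+ (k !)) (+ 1 + + k) (C (m ℕ.+ suc k) (suc k)) ⟩
    - sgn k * C (m ℕ.+ suc k) (suc k) * ((+ 1 + + k) * + (k !)) ≡⟨ cong (λ z → - sgn k * C (m ℕ.+ suc k) (suc k) * z) (sym (ℤP.pos-* (suc k) (k !))) ⟩
    - sgn k * C (m ℕ.+ suc k) (suc k) * + (suc k !) ∎
    where
    open ≡-Reasoning
    reorder : ∀ s x f m k → s * x * f * (- (+ 1 + m) - k) ≡ - s * f * ((+ 1 + (m + k)) * x)
    reorder = solve-∀
    reorder′ : ∀ s f a x → - s * f * (a * x) ≡ - s * x * (a * f)
    reorder′ = solve-∀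

  binomℤ-pos : ∀ n k → binomℤ (+ n) k ≡ ι (C n k)
  binomℤ-pos n k = trans (cong (λ z → ℚ._/_ z (k !) {{k ℕP.!≢0}}) (falling-pos n k)) (/-cancel (C n k) (k !) {{k ℕP.!≢0}})

  binomℤ-neg : ∀ m k → binomℤ (- + suc m) k ≡ ι (sgn k * C (m ℕ.+ k) k)
  binomℤ-neg m k = trans (cong (λ z → ℚ._/_ z (k !) {{k ℕP.!≢0}}) (falling-neg m k))
                         (/-cancel (sgn k * C (m ℕ.+ k) k) (k !) {{k ℕP.!≢0}})

module PartIIa where
  open import Data.Nat as ℕ using (ℕ; zero; suc; _<_)
  import Data.Nat.Properties as ℕP
  open import Data.Integer using (ℤ; +_; _+_; _*_; -_; _-_)
  import Data.Integer.Properties as ℤP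
  open import Data.Integer.Tactic.RingSolver using (solve-∀)
  open import Relation.Binary.PropositionalEquality
  open Choose using (choose-vanish)
  open BinomialZ
  open Central
  open Sums
  open Sign

  -- altSum n = Σ_{k ≤ n} (-1)^k c k C(n+k,2k), the integer value of R n (-1).
  altTerm : ℕ → ℕ → ℤ
  altTerm n k = sgn k * c k * C (n ℕ.+ k) (k ℕ.+ k)

  altSum : ℕ → ℤ
  altSum n = Σ< (suc n) (altTerm n)

  altTerm-vanish : ∀ n k → n < k → altTerm n k ≡ + 0
  altTerm-vanish n k n<k =
    trans (cong (λ z → sgn k * c k * + z) (choose-vanish (n ℕ.+ k) (k ℕ.+ k) (ℕP.+-monoˡ-< k n<k)))
          (ℤP.*-zeroʳ (sgn k * c k))

  catTerm : ℕ → ℕ → ℤ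
  catTerm N j = sgn j * catalan j * C (N ℕ.+ j) (j ℕ.+ j)

  -- Its partial sums have a closed form (a Gosper-style certificate):
  --   N(N+1) Σ_{i ≤ j} catTerm N i = (-1)^j (j+1)(j+2) Cat(j+1) C(N+1+j, 2j+2).
  catTerm-partial-sum : ∀ N j →
    (+ N * (+ 1 + + N)) * Σ< (suc j) (catTerm N)
      ≡ sgn j * (+ 1 + + j) * (+ 2 + + j) * catalan (suc j) * C (suc N ℕ.+ j) (suc j ℕ.+ suc j)
  catTerm-partial-sum N zero = begin
    (+ N * (+ 1 + + N)) * (+ 0 + + 1 * + 1 * + 1) ≡⟨ simplify (+ N) ⟩
    (+ 1 + + N) * + N                             ≡⟨ cong ((+ 1 + + N) *_) (sym (C-n-1 N)) ⟩
    (+ 1 + + N) * C N 1                           ≡⟨ sym (C-absorb N 1) ⟩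
    + 2 * C (suc N) 2                             ≡⟨ cong (λ z → + 2 * C z 2) (sym (ℕP.+-identityʳ (suc N))) ⟩
    + 2 * C (suc N ℕ.+ 0) 2 ∎
    where
    open ≡-Reasoning
    simplify : ∀ N → (N * (+ 1 + N)) * (+ 0 + + 1 * + 1 * + 1) ≡ (+ 1 + N) * N
    simplify = solve-∀
  catTerm-partial-sum N (suc j) = begin
    NN * (S + catTerm N (suc j))
      ≡⟨ distrib NN S (catTerm N (suc j)) ⟩
    NN * S + NN * catTerm N (suc j)
      ≡⟨ cong₂ (λ x y → x + NN * (- sgn j * catalan (suc j) * C y (suc j ℕ.+ suc j))) (catTerm-partial-sum N j) (ℕP.+-suc N j) ⟩
    sgn j * (+ 1 + + j) * (+ 2 + + j) * catalan (suc j) * X + NN * (- sgn j * catalan (suc j) * X)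
      ≡⟨ combine (sgn j) (+ j) (+ N) (catalan (suc j)) X ⟩
    - sgn j * catalan (suc j) * ((+ 1 + + a) * (+ a - + jj) * X)
      ≡⟨ cong (λ z → - sgn j * catalan (suc j) * z) (sym (C-absorb-twice a jj)) ⟩
    - sgn j * catalan (suc j) * ((+ 2 + + jj) * (+ 1 + + jj) * Y)
      ≡⟨ regroup (sgn j) (+ j) (catalan (suc j)) Y ⟩
    - sgn j * (+ 1 + + suc j) * (+ 2 * (+ 1 + (+ suc j + + suc j)) * catalan (suc j)) * Y
      ≡⟨ cong (λ z → - sgn j * (+ 1 + + suc j) * z * Y) (sym (catalan-succ (suc j))) ⟩
    - sgn j * (+ 1 + + suc j) * ((+ 2 + + suc j) * catalan (suc (suc j))) * Y
      ≡⟨ reassoc (sgn j) (+ suc j) (catalan (suc (suc j))) Y ⟩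
    - sgn j * (+ 1 + + suc j) * (+ 2 + + suc j) * catalan (suc (suc j)) * Y
      ≡⟨ cong₂ (λ u v → - sgn j * (+ 1 + + suc j) * (+ 2 + + suc j) * catalan (suc (suc j)) * C u v)
               (sym (ℕP.+-suc (suc N) j)) (cong suc (sym (ℕP.+-suc (suc j) (suc j)))) ⟩
    - sgn j * (+ 1 + + suc j) * (+ 2 + + suc j) * catalan (suc (suc j)) * C (suc N ℕ.+ suc j) (suc (suc j) ℕ.+ suc (suc j)) ∎
    where
    open ≡-Reasoning
    a = suc N ℕ.+ j
    jj = suc j ℕ.+ suc j
    NN = + N * (+ 1 + + N)
    S = Σ< (suc j) (catTerm N)
    X = C a jj
    Y = C (suc a) (suc (suc jj))
    distrib : ∀ a x y → a * (x + y) ≡ a * x + a * y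
    distrib = solve-∀
    combine : ∀ s j N t x → s * (+ 1 + j) * (+ 2 + j) * t * x + (N * (+ 1 + N)) * (- s * t * x)
                          ≡ - s * t * ((+ 1 + (+ 1 + N + j)) * (+ 1 + N + j - ((+ 1 + j) + (+ 1 + j))) * x)
    combine = solve-∀
    regroup : ∀ s j t y → - s * t * ((+ 2 + ((+ 1 + j) + (+ 1 + j))) * (+ 1 + ((+ 1 + j) + (+ 1 + j))) * y)
                        ≡ - s * (+ 1 + (+ 1 + j)) * (+ 2 * (+ 1 + ((+ 1 + j) + (+ 1 + j))) * t) * y
    regroup = solve-∀
    reassoc : ∀ s j z y → - s * (+ 1 + j) * ((+ 2 + j) * z) * y ≡ - s * (+ 1 + j) * (+ 2 + j) * z * y
    reassoc = solve-∀

  -- Hence the full alternating Catalan sum vanishes for N ≥ 1: at j = N the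
  -- closed form contains C(2N+1, 2N+2) = 0.
  catTerm-sum-vanish : ∀ N → Σ< (suc (suc N)) (catTerm (suc N)) ≡ + 0
  catTerm-sum-vanish N = ℤP.*-cancelˡ-≡ NN _ _ (begin
    NN * Σ< (suc (suc N)) (catTerm (suc N)) ≡⟨ catTerm-partial-sum (suc N) (suc N) ⟩
    Q * C (suc (suc N) ℕ.+ suc N) (suc (suc N) ℕ.+ suc (suc N))
      ≡⟨ cong (λ z → Q * + z) (choose-vanish _ _ (ℕP.+-monoʳ-< (suc (suc N)) (ℕP.n<1+n (suc N)))) ⟩
    Q * + 0 ≡⟨ ℤP.*-zeroʳ Q ⟩
    + 0     ≡⟨ sym (ℤP.*-zeroʳ NN) ⟩
    NN * + 0 ∎)
    where
    open ≡-Reasoning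
    NN = + suc N * (+ 1 + + suc N)
    Q = sgn (suc N) * (+ 1 + + suc N) * (+ 2 + + suc N) * catalan (suc (suc N))

  -- The second difference of altTerm in n: by `C-second-difference` it is
  -- 0 at k = 0 and -2 catTerm (n+1) (k-1) for k ≥ 1.
  altTerm-Δ² : ℕ → ℕ → ℤ
  altTerm-Δ² n zero = + 0
  altTerm-Δ² n (suc j) = - + 2 * catTerm (suc n) j

  altTerm-second-difference : ∀ n k →
    altTerm (suc (suc n)) k - + 2 * altTerm (suc n) k + altTerm n k ≡ altTerm-Δ² n k
  altTerm-second-difference n zero = refl
  altTerm-second-difference n (suc j) = begin
    s * cc * C (suc (suc n) ℕ.+ suc j) kk - + 2 * (s * cc * C (suc n ℕ.+ suc j) kk) + s * cc * C (n ℕ.+ suc j) kk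
      ≡⟨ factor (s * cc) (C (suc (suc n) ℕ.+ suc j) kk) (C (suc n ℕ.+ suc j) kk) (C (n ℕ.+ suc j) kk) ⟩
    s * cc * (C (suc (suc a)) kk - + 2 * C (suc a) kk + C a kk)
      ≡⟨ cong (λ z → s * cc * (C (suc (suc a)) z - + 2 * C (suc a) z + C a z)) (2[1+k]≡2+2k j) ⟩
    s * cc * (C (suc (suc a)) (suc (suc (j ℕ.+ j))) - + 2 * C (suc a) (suc (suc (j ℕ.+ j))) + C a (suc (suc (j ℕ.+ j))))
      ≡⟨ cong (s * cc *_) (C-second-difference a (j ℕ.+ j)) ⟩
    s * cc * C a (j ℕ.+ j)
      ≡⟨ cong (λ z → s * cc * C z (j ℕ.+ j)) (ℕP.+-suc n j) ⟩
    - sgn j * (+ 2 * catalan j) * C (suc n ℕ.+ j) (j ℕ.+ j)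
      ≡⟨ pull-out (sgn j) (catalan j) (C (suc n ℕ.+ j) (j ℕ.+ j)) ⟩
    - + 2 * catTerm (suc n) j ∎
    where
    open ≡-Reasoning
    s = sgn (suc j)
    cc = c (suc j)
    kk = suc j ℕ.+ suc j
    a = n ℕ.+ suc j
    factor : ∀ a x y z → a * x - + 2 * (a * y) + a * z ≡ a * (x - + 2 * y + z)
    factor = solve-∀
    pull-out : ∀ s t x → - s * (+ 2 * t) * x ≡ - + 2 * (s * t * x)
    pull-out = solve-∀

  -- So altSum is linear in n: its second difference is -2 times a vanishing
  -- alternating Catalan sum.
  altSum-second-difference : ∀ n → altSum (suc (suc n)) - + 2 * altSum (suc n) + altSum n ≡ + 0
  altSum-second-difference n = begin
    altSum (suc (suc n)) - + 2 * altSum (suc n) + altSum n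
      ≡⟨ cong₂ (λ x y → altSum (suc (suc n)) - + 2 * x + y)
               (sym (Σ<-pad (suc (suc n)) 1 (altTerm (suc n)) (altTerm-vanish (suc n))))
               (sym (Σ<-pad (suc n) 2 (altTerm n) (altTerm-vanish n))) ⟩
    Σ< M (altTerm (suc (suc n))) - + 2 * Σ< M (altTerm (suc n)) + Σ< M (altTerm n)
      ≡⟨ sym (Σ<-second-difference M (altTerm (suc (suc n))) (altTerm (suc n)) (altTerm n)) ⟩
    Σ< M (λ k → altTerm (suc (suc n)) k - + 2 * altTerm (suc n) k + altTerm n k)
      ≡⟨ Σ<-cong M (λ k _ → altTerm-second-difference n k) ⟩
    Σ< M (altTerm-Δ² n)
      ≡⟨ Σ<-head (suc (suc n)) (altTerm-Δ² n) ⟩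
    + 0 + Σ< (suc (suc n)) (λ j → - + 2 * catTerm (suc n) j)
      ≡⟨ cong (λ z → + 0 + z) (Σ<-* (suc (suc n)) (- + 2) (catTerm (suc n))) ⟩
    + 0 + - + 2 * Σ< (suc (suc n)) (catTerm (suc n))
      ≡⟨ cong (λ z → + 0 + - + 2 * z) (catTerm-sum-vanish n) ⟩
    + 0 ∎
    where
    open ≡-Reasoning
    M = suc (suc (suc n))
    Σ<-second-difference : ∀ m (f g h : ℕ → ℤ) →
      Σ< m (λ k → f k - + 2 * g k + h k) ≡ Σ< m f - + 2 * Σ< m g + Σ< m h
    Σ<-second-difference zero f g h = refl
    Σ<-second-difference (suc m) f g h =
      trans (cong (_+ (f m - + 2 * g m + h m)) (Σ<-second-difference m f g h))
            (regroup (Σ< m f) (Σ< m g) (Σ< m h) (f m) (g m) (h m))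
      where
      regroup : ∀ a b c x y z → a - + 2 * b + c + (x - + 2 * y + z) ≡ a + x - + 2 * (b + y) + (c + z)
      regroup = solve-∀

  altSum-value : ∀ n → altSum n ≡ - (+ 1 + (+ n + + n))
  altSum-value zero = refl
  altSum-value (suc zero) = refl
  altSum-value (suc (suc n)) = begin
    altSum (suc (suc n))
      ≡⟨ isolate (altSum (suc (suc n))) (altSum (suc n)) (altSum n) ⟩
    (altSum (suc (suc n)) - + 2 * altSum (suc n) + altSum n) + + 2 * altSum (suc n) - altSum n
      ≡⟨ cong₃ (λ x y z → x + + 2 * y - z) (altSum-second-difference n) (altSum-value (suc n)) (altSum-value n) ⟩
    + 0 + + 2 * - (+ 1 + (+ suc n + + suc n)) - - (+ 1 + (+ n + + n))
      ≡⟨ linear (+ n) ⟩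
    - (+ 1 + (+ suc (suc n) + + suc (suc n))) ∎
    where
    open ≡-Reasoning
    cong₃ : ∀ {x x′ y y′ z z′ : ℤ} (f : ℤ → ℤ → ℤ → ℤ) → x ≡ x′ → y ≡ y′ → z ≡ z′ → f x y z ≡ f x′ y′ z′
    cong₃ f refl refl refl = refl
    isolate : ∀ a b c → a ≡ (a - + 2 * b + c) + + 2 * b - c
    isolate = solve-∀
    linear : ∀ n → + 0 + + 2 * - (+ 1 + ((+ 1 + n) + (+ 1 + n))) - - (+ 1 + (n + n)) ≡ - (+ 1 + ((+ 2 + n) + (+ 2 + n)))
    linear = solve-∀

module PartIIb where
  open import Data.Nat as ℕ using (ℕ; zero; suc)
  open import Data.Integer using (ℤ; +_; _+_; _*_; -_; _-_)
  import Data.Integer.Properties as ℤP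
  open import Data.Integer.Tactic.RingSolver using (solve-∀)
  open import Relation.Binary.PropositionalEquality
  open BinomialZ
  open Central
  open Sums
  open Sign
  open PartIIa

  -- With n = m+1, the k-th term of Σ_k C(n,k) C(-n,k)/(2k-1) is
  -- (-1)^k C(m+1,k) C(m+k,k)/(2k-1) = (-1)^k pairTerm m k (see den*pairTerm),
  -- and 2 pairTerm m k is the sum of the k-th terms of R (m+1) 1 and R m 1.
  pairTerm : ℕ → ℕ → ℤ
  pairTerm m zero = - + 1
  pairTerm m (suc j) = catalan j * (C (suc m ℕ.+ suc j) (suc j ℕ.+ suc j) + C (m ℕ.+ suc j) (suc j ℕ.+ suc j))

  -- With P, U, V, Q the four coefficients below, this follows from
  -- (j+1) U = (m+1) V  and  (m+1) Q = (m-j) P  after multiplying by m+1.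
  C-product-average : ∀ m j →
    + 2 * (C (suc m) (suc j) * C (m ℕ.+ suc j) (suc j))
      ≡ C (suc m) (suc j) * C (suc m ℕ.+ suc j) (suc j) + C m (suc j) * C (m ℕ.+ suc j) (suc j)
  C-product-average m j = ℤP.*-cancelˡ-≡ (+ 1 + + m) _ _ (begin
    (+ 1 + + m) * (+ 2 * (P * U))
      ≡⟨ split (+ m) (+ j) P U V Q ⟩
    (+ 1 + + m) * (P * (V + U) + Q * U) + ((+ 1 + + j) * U - (+ m + + suc j - + j) * V) * P - ((+ 1 + + m) * Q - (+ m - + j) * P) * U
      ≡⟨ cong₂ (λ x y → (+ 1 + + m) * (P * (V + U) + Q * U) + x * P - y * U)
               (ℤP.i≡j⇒i-j≡0 (C-absorb-lower (m ℕ.+ suc j) j)) (ℤP.i≡j⇒i-j≡0 Q-from-P) ⟩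
    (+ 1 + + m) * (P * (V + U) + Q * U) + + 0 * P - + 0 * U
      ≡⟨ drop-zeros ((+ 1 + + m) * (P * (V + U) + Q * U)) P U ⟩
    (+ 1 + + m) * (P * (V + U) + Q * U)
      ≡⟨ cong (λ z → (+ 1 + + m) * (P * z + Q * U)) (sym (C-pascal (m ℕ.+ suc j) j)) ⟩
    (+ 1 + + m) * (P * C (suc m ℕ.+ suc j) (suc j) + Q * U) ∎)
    where
    open ≡-Reasoning
    P = C (suc m) (suc j)
    U = C (m ℕ.+ suc j) (suc j)
    V = C (m ℕ.+ suc j) j
    Q = C m (suc j)
    Q-from-P : (+ 1 + + m) * Q ≡ (+ m - + j) * P
    Q-from-P = begin
      (+ 1 + + m) * Q                         ≡⟨ rearrange (+ m) (+ j) Q (C m j) ⟩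
      (+ 1 + + j) * (C m j + Q) - (+ 1 + + m) * C m j + (+ m - + j) * (C m j + Q)
        ≡⟨ cong (λ z → (+ 1 + + j) * z - (+ 1 + + m) * C m j + (+ m - + j) * z) (sym (C-pascal m j)) ⟩
      (+ 1 + + j) * P - (+ 1 + + m) * C m j + (+ m - + j) * P
        ≡⟨ cong (λ z → z + (+ m - + j) * P) (ℤP.i≡j⇒i-j≡0 (C-absorb m j)) ⟩
      + 0 + (+ m - + j) * P                   ≡⟨ ℤP.+-identityˡ _ ⟩
      (+ m - + j) * P ∎
      where
      rearrange : ∀ m j q x → (+ 1 + m) * q ≡ (+ 1 + j) * (x + q) - (+ 1 + m) * x + (m - j) * (x + q)
      rearrange = solve-∀
    split : ∀ m j P U V Q → (+ 1 + m) * (+ 2 * (P * U))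
          ≡ (+ 1 + m) * (P * (V + U) + Q * U) + ((+ 1 + j) * U - (m + (+ 1 + j) - j) * V) * P - ((+ 1 + m) * Q - (m - j) * P) * U
    split = solve-∀
    drop-zeros : ∀ a x y → a + + 0 * x - + 0 * y ≡ a
    drop-zeros = solve-∀

  den*pairTerm : ∀ m k → den k * pairTerm m k ≡ C (suc m) k * C (m ℕ.+ k) k
  den*pairTerm m zero = refl
  den*pairTerm m (suc j) = ℤP.*-cancelˡ-≡ (+ 2) _ _ (begin
    + 2 * (den (suc j) * (catalan j * (X₁ + X₀)))
      ≡⟨ expand (+ j) (catalan j) X₁ X₀ ⟩
    (+ 2 * (+ 1 + (+ j + + j)) * catalan j) * X₁ + (+ 2 * (+ 1 + (+ j + + j)) * catalan j) * X₀
      ≡⟨ cong (λ z → z * X₁ + z * X₀) (sym (C-central-succ j)) ⟩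
    central * X₁ + central * X₀
      ≡⟨ cong₂ _+_ (sym (C-trinomial-revision (suc m) (suc j))) (sym (C-trinomial-revision m (suc j))) ⟩
    C (suc m) (suc j) * C (suc m ℕ.+ suc j) (suc j) + C m (suc j) * C (m ℕ.+ suc j) (suc j)
      ≡⟨ sym (C-product-average m j) ⟩
    + 2 * (C (suc m) (suc j) * C (m ℕ.+ suc j) (suc j)) ∎)
    where
    open ≡-Reasoning
    central = C (suc j ℕ.+ suc j) (suc j)
    X₁ = C (suc m ℕ.+ suc j) (suc j ℕ.+ suc j)
    X₀ = C (m ℕ.+ suc j) (suc j ℕ.+ suc j)
    expand : ∀ j t x y → + 2 * ((+ 1 + j + (+ 1 + j) - + 1) * (t * (x + y)))
           ≡ (+ 2 * (+ 1 + (j + j)) * t) * x + (+ 2 * (+ 1 + (j + j)) * t) * y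
    expand = solve-∀

  pairTerm-altTerm : ∀ m k → + 2 * (sgn k * pairTerm m k) ≡ altTerm (suc m) k + altTerm m k
  pairTerm-altTerm m zero = refl
  pairTerm-altTerm m (suc j) =
    distrib (sgn (suc j)) (catalan j) (C (suc m ℕ.+ suc j) (suc j ℕ.+ suc j)) (C (m ℕ.+ suc j) (suc j ℕ.+ suc j))
    where
    distrib : ∀ s t x y → + 2 * (s * (t * (x + y))) ≡ s * (+ 2 * t) * x + s * (+ 2 * t) * y
    distrib = solve-∀

  -- Part (ii), second identity, over ℤ:  the sum is (altSum (m+1) + altSum m)/2 = -2(m+1).
  pairSum-value : ∀ m → Σ< (suc (suc m)) (λ k → sgn k * pairTerm m k) ≡ - (+ 2 * (+ 1 + + m))
  pairSum-value m = ℤP.*-cancelˡ-≡ (+ 2) _ _ (begin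
    + 2 * Σ< (suc (suc m)) (λ k → sgn k * pairTerm m k)
      ≡⟨ sym (Σ<-* (suc (suc m)) (+ 2) (λ k → sgn k * pairTerm m k)) ⟩
    Σ< (suc (suc m)) (λ k → + 2 * (sgn k * pairTerm m k))
      ≡⟨ Σ<-cong (suc (suc m)) (λ k _ → pairTerm-altTerm m k) ⟩
    Σ< (suc (suc m)) (λ k → altTerm (suc m) k + altTerm m k)
      ≡⟨ Σ<-+ (suc (suc m)) (altTerm (suc m)) (altTerm m) ⟩
    altSum (suc m) + Σ< (suc (suc m)) (altTerm m)
      ≡⟨ cong (λ z → altSum (suc m) + z) (Σ<-pad (suc m) 1 (altTerm m) (altTerm-vanish m)) ⟩
    altSum (suc m) + altSum m
      ≡⟨ cong₂ _+_ (altSum-value (suc m)) (altSum-value m) ⟩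
    - (+ 1 + (+ suc m + + suc m)) + - (+ 1 + (+ m + + m))
      ≡⟨ collect (+ m) ⟩
    + 2 * - (+ 2 * (+ 1 + + m)) ∎)
    where
    open ≡-Reasoning
    collect : ∀ m → - (+ 1 + ((+ 1 + m) + (+ 1 + m))) + - (+ 1 + (m + m)) ≡ + 2 * - (+ 2 * (+ 1 + m))
    collect = solve-∀

module Primes where
  open import Data.Nat using (zero; suc; _<_)
  import Data.Nat.Divisibility as ℕ∣
  open import Data.Nat.Primality using (Prime; euclidsLemma; prime⇒nonZero)
  open import Data.Integer as ℤ using (ℤ; +_; _*_; _^_)
  import Data.Integer.Properties as ℤP
  open import Data.Integer.Divisibility.Signed using (_∣_; divides; ∣⇒∣ᵤ; ∣ᵤ⇒∣)
  open import Data.Integer.Tactic.RingSolver using (solve-∀)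
  open import Data.Sum using (_⊎_; inj₁; inj₂)
  open import Data.Empty using (⊥-elim)
  open import Relation.Nullary using (¬_)
  open import Relation.Binary.PropositionalEquality

  euclid : ∀ {p} → Prime p → ∀ a x → + p ∣ a * x → + p ∣ a ⊎ + p ∣ x
  euclid {p} p-prime a x p∣ax with euclidsLemma ℤ.∣ a ∣ ℤ.∣ x ∣ p-prime (subst (p ℕ∣.∣_) (ℤP.abs-* a x) (∣⇒∣ᵤ p∣ax))
  ... | inj₁ p∣a = inj₁ (∣ᵤ⇒∣ p∣a)
  ... | inj₂ p∣x = inj₂ (∣ᵤ⇒∣ p∣x)

  ∤-small : ∀ {p n} → 0 < n → n < p → ¬ + p ∣ + n
  ∤-small {p} {suc n} _ n<p p∣n = ℕ∣.>⇒∤ n<p (∣⇒∣ᵤ p∣n)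

  ∤-* : ∀ {p} → Prime p → ∀ a x → ¬ + p ∣ a → ¬ + p ∣ x → ¬ + p ∣ a * x
  ∤-* p-prime a x p∤a p∤x p∣ax with euclid p-prime a x p∣ax
  ... | inj₁ p∣a = p∤a p∣a
  ... | inj₂ p∣x = p∤x p∣x

  ∣-cancel : ∀ {p} → Prime p → ∀ e a x → ¬ + p ∣ a → (+ p) ^ e ∣ a * x → (+ p) ^ e ∣ x
  ∣-cancel p-prime zero a x _ _ = divides x (sym (ℤP.*-identityʳ x))
  ∣-cancel {p} p-prime (suc e) a x p∤a (divides q ax≡q·pᵉ⁺¹)
    with euclid p-prime a x (divides (q * (+ p) ^ e) (trans ax≡q·pᵉ⁺¹ (reassoc q (+ p) ((+ p) ^ e))))
    where
    reassoc : ∀ q p m → q * (p * m) ≡ q * m * p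
    reassoc = solve-∀
  ... | inj₁ p∣a = ⊥-elim (p∤a p∣a)
  ... | inj₂ (divides y refl) with ∣-cancel p-prime e a y p∤a (divides q ay≡q·pᵉ)
    where
    instance
      _ : ℤ.NonZero (+ p)
      _ = prime⇒nonZero p-prime
    ay≡q·pᵉ : a * y ≡ q * (+ p) ^ e
    ay≡q·pᵉ = ℤP.*-cancelˡ-≡ (+ p) _ _ (trans (reassoc a y (+ p)) (trans ax≡q·pᵉ⁺¹ (reassoc′ q (+ p) ((+ p) ^ e))))
      where
      reassoc : ∀ a y p → p * (a * y) ≡ a * (y * p)
      reassoc = solve-∀
      reassoc′ : ∀ q p m → q * (p * m) ≡ p * (q * m)
      reassoc′ = solve-∀
  ... | divides r y≡r·pᵉ = divides r (trans (cong (_* + p) y≡r·pᵉ) (reassoc r ((+ p) ^ e) (+ p)))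
    where
    reassoc : ∀ r m p → r * m * p ≡ r * (p * m)
    reassoc = solve-∀

  ∣-cancelˡ : ∀ {p} → Prime p → ∀ a x → ¬ + p ∣ a → + p ∣ a * x → + p ∣ x
  ∣-cancelˡ p-prime a x p∤a p∣ax with euclid p-prime a x p∣ax
  ... | inj₁ p∣a = ⊥-elim (p∤a p∣a)
  ... | inj₂ p∣x = p∣x

module FermatWilson where
  open import Data.Nat as ℕ using (ℕ; zero; suc; _<_; z≤n; s≤s; _!)
  import Data.Nat.Properties as ℕP
  import Data.Nat.Divisibility as ℕ∣
  open import Data.Nat.Primality using (Prime; prime⇒nonZero)
  open import Data.Integer as ℤ using (ℤ; +_; _+_; _*_; -_; _-_; _^_)
  import Data.Integer.Properties as ℤP
  open import Data.Integer.Divisibility.Signed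
    using (_∣_; divides; ∣m∣n⇒∣m+n; ∣m⇒∣-m; ∣n⇒∣m*n; ∣m⇒∣m*n; ∣⇒∣ᵤ; ∣ᵤ⇒∣)
  open import Data.Integer.Tactic.RingSolver using (solve-∀)
  open import Data.Product using (_,_)
  open import Data.Sum using (inj₁; inj₂)
  open import Data.Empty using (⊥-elim)
  open import Relation.Nullary using (¬_)
  open import Relation.Binary.PropositionalEquality
  open Choose using (choose-vanish; choose-diag)
  open BinomialZ
  open Sums
  open Sign
  open Primes
  open import Defs using (Legendre; leg0; leg1; leg-1)

  binomial-theorem : ∀ n x → (x + + 1) ^ n ≡ Σ< (suc n) (λ k → C n k * x ^ k)
  binomial-theorem zero x = refl
  binomial-theorem (suc n) x = begin
    (x + + 1) * (x + + 1) ^ n ≡⟨ cong ((x + + 1) *_) (binomial-theorem n x) ⟩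
    (x + + 1) * S             ≡⟨ distrib x S ⟩
    x * S + S                 ≡⟨ cong₂ _+_ (sym (Σ<-* (suc n) x (λ k → C n k * x ^ k))) S-shifted ⟩
    Σ< (suc n) (λ k → x * (C n k * x ^ k)) + (+ 1 + Σ< (suc n) (λ k → C n (suc k) * x ^ suc k))
      ≡⟨ rotate (Σ< (suc n) (λ k → x * (C n k * x ^ k))) (Σ< (suc n) (λ k → C n (suc k) * x ^ suc k)) ⟩
    + 1 + (Σ< (suc n) (λ k → x * (C n k * x ^ k)) + Σ< (suc n) (λ k → C n (suc k) * x ^ suc k))
      ≡⟨ cong (λ z → + 1 + z) (sym (Σ<-+ (suc n) _ _)) ⟩
    + 1 + Σ< (suc n) (λ k → x * (C n k * x ^ k) + C n (suc k) * x ^ suc k)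
      ≡⟨ cong (λ z → + 1 + z) (Σ<-cong (suc n) (λ k _ → pascal-term k)) ⟩
    + 1 + Σ< (suc n) (λ k → C (suc n) (suc k) * x ^ suc k)
      ≡⟨ sym (Σ<-head (suc n) (λ k → C (suc n) k * x ^ k)) ⟩
    Σ< (suc (suc n)) (λ k → C (suc n) k * x ^ k) ∎
    where
    open ≡-Reasoning
    S = Σ< (suc n) (λ k → C n k * x ^ k)
    distrib : ∀ x s → (x + + 1) * s ≡ x * s + s
    distrib = solve-∀
    rotate : ∀ a c → a + (+ 1 + c) ≡ + 1 + (a + c)
    rotate = solve-∀
    S-shifted : S ≡ + 1 + Σ< (suc n) (λ k → C n (suc k) * x ^ suc k)
    S-shifted = begin
      S                                         ≡⟨ sym (ℤP.+-identityʳ S) ⟩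
      S + + 0                                   ≡⟨ cong (λ z → S + + z * x ^ suc n) (sym (choose-vanish n (suc n) (ℕP.n<1+n n))) ⟩
      Σ< (suc (suc n)) (λ k → C n k * x ^ k)    ≡⟨ Σ<-head (suc n) (λ k → C n k * x ^ k) ⟩
      + 1 * + 1 + Σ< (suc n) (λ k → C n (suc k) * x ^ suc k) ∎
    pascal-term : ∀ k → x * (C n k * x ^ k) + C n (suc k) * x ^ suc k ≡ C (suc n) (suc k) * x ^ suc k
    pascal-term k = trans (collect x (C n k) (C n (suc k)) (x ^ k)) (cong (λ z → z * (x * x ^ k)) (sym (C-pascal n k)))
      where
      collect : ∀ x a c w → x * (a * w) + c * (x * w) ≡ (a + c) * (x * w)
      collect = solve-∀

  -- p ∣ C(p,k) for 0 < k < p: from k C(p,k) = p C(p-1,k-1) and p ∤ k.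
  prime∣C : ∀ {p} → Prime p → ∀ k → 0 < k → k < p → + p ∣ C p k
  prime∣C {suc p′} p-prime (suc k′) _ k<p =
    ∣-cancelˡ p-prime (+ 1 + + k′) (C (suc p′) (suc k′)) (∤-small (s≤s z≤n) k<p)
      (divides (C p′ k′) (trans (C-absorb p′ k′) (ℤP.*-comm (+ 1 + + p′) (C p′ k′))))

  freshman's-dream : ∀ {p} → Prime p → ∀ x → + p ∣ (x + + 1) ^ p - x ^ p - + 1
  freshman's-dream {zero} p-prime x = ⊥-elim (ℕ.≢-nonZero⁻¹ 0 {{prime⇒nonZero p-prime}} refl)
  freshman's-dream {suc p′} p-prime x =
    subst (+ p ∣_) (sym middle-terms)
      (∣-Σ< (+ p) p′ inner (λ k k<p′ → ∣m⇒∣m*n (x ^ suc k) (prime∣C p-prime (suc k) (s≤s z≤n) (s≤s k<p′))))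
    where
    p = suc p′
    inner = λ k → C p (suc k) * x ^ suc k
    middle-terms : (x + + 1) ^ p - x ^ p - + 1 ≡ Σ< p′ inner
    middle-terms = begin
      (x + + 1) ^ p - x ^ p - + 1 ≡⟨ cong (λ z → z - x ^ p - + 1) (binomial-theorem p x) ⟩
      Σ< (suc p) (λ k → C p k * x ^ k) - x ^ p - + 1
        ≡⟨ cong (λ z → z - x ^ p - + 1) (Σ<-head p (λ k → C p k * x ^ k)) ⟩
      + 1 * + 1 + (Σ< p′ inner + C p p * x ^ p) - x ^ p - + 1
        ≡⟨ cong (λ z → + 1 * + 1 + (Σ< p′ inner + + z * x ^ p) - x ^ p - + 1) (choose-diag p) ⟩
      + 1 * + 1 + (Σ< p′ inner + + 1 * x ^ p) - x ^ p - + 1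
        ≡⟨ cancel (Σ< p′ inner) (x ^ p) ⟩
      Σ< p′ inner ∎
      where
      open ≡-Reasoning
      cancel : ∀ s w → + 1 * + 1 + (s + + 1 * w) - w - + 1 ≡ s
      cancel = solve-∀

  fermat : ∀ {p} → Prime p → ∀ a → + p ∣ (+ a) ^ p - + a
  fermat {zero} p-prime a = ⊥-elim (ℕ.≢-nonZero⁻¹ 0 {{prime⇒nonZero p-prime}} refl)
  fermat {suc p′} p-prime zero = divides (+ 0) refl
  fermat {p@(suc _)} p-prime (suc a) =
    subst (+ p ∣_) (sym telescope) (∣m∣n⇒∣m+n (freshman's-dream p-prime (+ a)) (fermat p-prime a))
    where
    telescope : (+ suc a) ^ p - + suc a ≡ ((+ a + + 1) ^ p - (+ a) ^ p - + 1) + ((+ a) ^ p - + a)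
    telescope = trans (cong (λ z → z ^ p - z) (cong +_ (ℕP.+-comm 1 a)))
                      (split ((+ a + + 1) ^ p) ((+ a) ^ p) (+ a))
      where
      split : ∀ u w a → u - (a + + 1) ≡ (u - w - + 1) + (w - a)
      split = solve-∀

  ^-double : ∀ x n → x ^ (n ℕ.+ n) ≡ (x * x) ^ n
  ^-double x zero = refl
  ^-double x (suc n) = begin
    x * x ^ (n ℕ.+ suc n)  ≡⟨ cong (λ z → x * x ^ z) (ℕP.+-suc n n) ⟩
    x * (x * x ^ (n ℕ.+ n)) ≡⟨ cong (λ z → x * (x * z)) (^-double x n) ⟩
    x * (x * (x * x) ^ n)  ≡⟨ sym (ℤP.*-assoc x x _) ⟩
    x * x * (x * x) ^ n ∎
    where open ≡-Reasoning

  ∣-^-difference : ∀ m a b n → m ∣ a - b → m ∣ a ^ n - b ^ n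
  ∣-^-difference m a b zero _ = divides (+ 0) (trans (ℤP.+-inverseʳ (+ 1)) (sym (ℤP.*-zeroˡ m)))
  ∣-^-difference m a b (suc n) m∣a-b =
    subst (m ∣_) (telescope a b (a ^ n) (b ^ n))
      (∣m∣n⇒∣m+n (∣n⇒∣m*n a (∣-^-difference m a b n m∣a-b)) (∣n⇒∣m*n (b ^ n) m∣a-b))
    where
    telescope : ∀ a b x y → a * (x - y) + y * (a - b) ≡ a * x - b * y
    telescope = solve-∀

  finDiff : ℕ → ℕ → ℤ → ℤ
  finDiff n m a = Σ< (suc n) (λ k → sgn k * C n k * (+ k + a) ^ m)

  -- Writing (k+a)^(m+1) = k (k+a)^m + a (k+a)^m and absorbing k into C(n+1,k):
  finDiff-step : ∀ n m a → finDiff (suc n) (suc m) a ≡ - (+ 1 + + n) * finDiff n m (a + + 1) + a * finDiff (suc n) m a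
  finDiff-step n m a = begin
    finDiff (suc n) (suc m) a
      ≡⟨ Σ<-cong (suc (suc n)) (λ k _ → split (sgn k) (C (suc n) k) (+ k) a ((+ k + a) ^ m)) ⟩
    Σ< (suc (suc n)) (λ k → sgn k * C (suc n) k * + k * (+ k + a) ^ m + a * (sgn k * C (suc n) k * (+ k + a) ^ m))
      ≡⟨ Σ<-+ (suc (suc n)) _ _ ⟩
    Σ< (suc (suc n)) (λ k → sgn k * C (suc n) k * + k * (+ k + a) ^ m) + Σ< (suc (suc n)) (λ k → a * (sgn k * C (suc n) k * (+ k + a) ^ m))
      ≡⟨ cong₂ _+_ (Σ<-head (suc n) _) (Σ<-* (suc (suc n)) a _) ⟩
    + 1 * + 1 * + 0 * (+ 0 + a) ^ m + Σ< (suc n) (λ j → sgn (suc j) * C (suc n) (suc j) * + suc j * (+ suc j + a) ^ m) + a * finDiff (suc n) m a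
      ≡⟨ cong (λ z → z + a * finDiff (suc n) m a) (drop-zero ((+ 0 + a) ^ m) (Σ< (suc n) (λ j → sgn (suc j) * C (suc n) (suc j) * + suc j * (+ suc j + a) ^ m))) ⟩
    Σ< (suc n) (λ j → sgn (suc j) * C (suc n) (suc j) * + suc j * (+ suc j + a) ^ m) + a * finDiff (suc n) m a
      ≡⟨ cong (λ z → z + a * finDiff (suc n) m a) (Σ<-cong (suc n) (λ j _ → absorb-index j)) ⟩
    Σ< (suc n) (λ j → - (+ 1 + + n) * (sgn j * C n j * (+ j + (a + + 1)) ^ m)) + a * finDiff (suc n) m a
      ≡⟨ cong (λ z → z + a * finDiff (suc n) m a) (Σ<-* (suc n) (- (+ 1 + + n)) _) ⟩
    - (+ 1 + + n) * finDiff n m (a + + 1) + a * finDiff (suc n) m a ∎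
    where
    open ≡-Reasoning
    split : ∀ s c k a w → s * c * ((k + a) * w) ≡ s * c * k * w + a * (s * c * w)
    split = solve-∀
    drop-zero : ∀ w z → + 1 * + 1 * + 0 * w + z ≡ z
    drop-zero = solve-∀
    absorb-index : ∀ j → sgn (suc j) * C (suc n) (suc j) * + suc j * (+ suc j + a) ^ m
                       ≡ - (+ 1 + + n) * (sgn j * C n j * (+ j + (a + + 1)) ^ m)
    absorb-index j = begin
      - sgn j * C (suc n) (suc j) * + suc j * (+ suc j + a) ^ m
        ≡⟨ cong (λ z → - sgn j * C (suc n) (suc j) * + suc j * z ^ m) (shift (+ j) a) ⟩
      - sgn j * C (suc n) (suc j) * (+ 1 + + j) * W     ≡⟨ reorder (sgn j) (C (suc n) (suc j)) (+ 1 + + j) W ⟩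
      - sgn j * ((+ 1 + + j) * C (suc n) (suc j)) * W   ≡⟨ cong (λ z → - sgn j * z * W) (C-absorb n j) ⟩
      - sgn j * ((+ 1 + + n) * C n j) * W               ≡⟨ reorder′ (sgn j) (+ 1 + + n) (C n j) W ⟩
      - (+ 1 + + n) * (sgn j * C n j * W) ∎
      where
      W = (+ j + (a + + 1)) ^ m
      shift : ∀ j a → (+ 1 + j) + a ≡ j + (a + + 1)
      shift = solve-∀
      reorder : ∀ s c k w → - s * c * k * w ≡ - s * (k * c) * w
      reorder = solve-∀
      reorder′ : ∀ s q c w → - s * (q * c) * w ≡ - q * (s * c * w)
      reorder′ = solve-∀

  -- finDiff n m a = 0 for m < n; the base case m = 0 is (1 - 1)^n = 0.
  finDiff-vanish : ∀ m n a → m < n → finDiff n m a ≡ + 0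
  finDiff-vanish zero (suc n) a _ = begin
    finDiff (suc n) 0 a                            ≡⟨ Σ<-cong (suc (suc n)) (λ k _ → trans (reorder (sgn k) (C (suc n) k)) (cong (C (suc n) k *_) (sym ([-1]^≡sgn k)))) ⟩
    Σ< (suc (suc n)) (λ k → C (suc n) k * (- + 1) ^ k) ≡⟨ sym (binomial-theorem (suc n) (- + 1)) ⟩
    + 0 ∎
    where
    open ≡-Reasoning
    reorder : ∀ s c → s * c * + 1 ≡ c * s
    reorder = solve-∀
  finDiff-vanish (suc m) (suc n) a (s≤s m<n) =
    trans (finDiff-step n m a)
          (trans (cong₂ (λ x y → - (+ 1 + + n) * x + a * y) (finDiff-vanish m n (a + + 1) m<n) (finDiff-vanish m (suc n) a (ℕP.m<n⇒m<1+n m<n)))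
                 (annihilate (+ n) a))
    where
    annihilate : ∀ n a → - (+ 1 + n) * + 0 + a * + 0 ≡ + 0
    annihilate = solve-∀

  finDiff-top : ∀ n a → finDiff n n a ≡ sgn n * + (n !)
  finDiff-top zero a = refl
  finDiff-top (suc n) a =
    trans (finDiff-step n n a)
          (trans (cong₂ (λ x y → - (+ 1 + + n) * x + a * y) (finDiff-top n (a + + 1)) (finDiff-vanish n (suc n) a (ℕP.n<1+n n)))
                 (trans (collect (+ n) a (sgn n) (+ (n !))) (cong (λ z → - sgn n * z) (sym (ℤP.pos-* (suc n) (n !))))))
    where
    collect : ∀ n a s f → - (+ 1 + n) * (s * f) + a * + 0 ≡ - s * ((+ 1 + n) * f)
    collect = solve-∀

  -- From here on p = 2h+1 is an odd prime, h = g+1 ≥ 1.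
  module OddPrime (g : ℕ) (p-prime : Prime (suc (suc g ℕ.+ suc g))) where
    h = suc g
    n = h ℕ.+ h
    p = suc n

    2<p : 2 < p
    2<p = s≤s (s≤s (subst (1 ℕ.≤_) (sym (ℕP.+-suc g g)) (s≤s z≤n)))

    fermat-unit : ∀ a → ¬ + p ∣ + a → + p ∣ (+ a) ^ n - + 1
    fermat-unit a p∤a =
      ∣-cancelˡ p-prime (+ a) ((+ a) ^ n - + 1) p∤a
        (subst (+ p ∣_) (factor (+ a) ((+ a) ^ n)) (fermat p-prime a))
      where
      factor : ∀ a w → a * w - a ≡ a * (w - + 1)
      factor = solve-∀

    -- Wilson's theorem (p-1)! ≡ -1 (mod p), from the n-th finite difference of
    -- x^n: Σ_k (-1)^k C(n,k) (k^n - 1) = n!, and each term with k ≥ 1 is ≡ 0.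
    wilson : + p ∣ + (n !) + + 1
    wilson = subst (+ p ∣_) (sym n!+1≡Σ)
      (∣-Σ< (+ p) n unitTerm (λ j j<n → ∣n⇒∣m*n (sgn (suc j) * C n (suc j))
        (fermat-unit (suc j ℕ.+ 0) (∤-small (s≤s z≤n) (s≤s (ℕP.≤-trans (ℕP.≤-reflexive (ℕP.+-identityʳ (suc j))) j<n))))))
      where
      term : ℕ → ℤ
      term k = sgn k * C n k * ((+ k + + 0) ^ n - + 1)
      unitTerm : ℕ → ℤ
      unitTerm j = term (suc j)
      difference : finDiff n n (+ 0) - finDiff n 0 (+ 0) ≡ Σ< (suc n) term
      difference = begin
        finDiff n n (+ 0) - finDiff n 0 (+ 0)
          ≡⟨ cong (λ z → finDiff n n (+ 0) + z) (sym (Σ<-neg (suc n) _)) ⟩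
        finDiff n n (+ 0) + Σ< (suc n) (λ k → - (sgn k * C n k * (+ k + + 0) ^ 0))
          ≡⟨ sym (Σ<-+ (suc n) _ _) ⟩
        Σ< (suc n) (λ k → sgn k * C n k * (+ k + + 0) ^ n + - (sgn k * C n k * (+ k + + 0) ^ 0))
          ≡⟨ Σ<-cong (suc n) (λ k _ → factor (sgn k * C n k) ((+ k + + 0) ^ n)) ⟩
        Σ< (suc n) term ∎
        where
        open ≡-Reasoning
        factor : ∀ c w → c * w + - (c * + 1) ≡ c * (w - + 1)
        factor = solve-∀
      n!+1≡Σ : + (n !) + + 1 ≡ Σ< n unitTerm
      n!+1≡Σ = begin
        + (n !) + + 1
          ≡⟨ sym (trivial (+ (n !))) ⟩
        + 1 * + (n !) - + 0 + + 1
          ≡⟨ cong₂ (λ x y → x - y + + 1) (sym (trans (finDiff-top n (+ 0)) (cong (_* + (n !)) (sgn-even h))))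
                                         (sym (finDiff-vanish 0 n (+ 0) (s≤s z≤n))) ⟩
        finDiff n n (+ 0) - finDiff n 0 (+ 0) + + 1
          ≡⟨ cong (λ z → z + + 1) difference ⟩
        Σ< (suc n) term + + 1
          ≡⟨ cong (λ z → z + + 1) (Σ<-head n term) ⟩
        + 1 * + 1 * (+ 0 - + 1) + Σ< n unitTerm + + 1
          ≡⟨ cancel (Σ< n unitTerm) ⟩
        Σ< n unitTerm ∎
        where
        open ≡-Reasoning
        trivial : ∀ x → + 1 * x - + 0 + + 1 ≡ x + + 1
        trivial = solve-∀
        cancel : ∀ s → + 1 * + 1 * (+ 0 - + 1) + s + + 1 ≡ s
        cancel = solve-∀

    private
      H² : ℤ
      H² = + (h !) * + (h !)

    -- (h+m)! r! ≡ (-1)^m (h!)² (mod p) whenever m + r = h: moving a factor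
    -- from r! to the other side replaces r+1 by h+m+1 ≡ -(r+1).
    half-factorials : ∀ m r → m ℕ.+ r ≡ h → + p ∣ + ((h ℕ.+ m) !) * + (r !) - sgn m * H²
    half-factorials zero r refl =
      subst (+ p ∣_) (sym (trans (cong (λ z → + (z !) * + (r !) - + 1 * H²) (ℕP.+-identityʳ r)) (cancel (+ (r !)))))
            (divides (+ 0) refl)
      where
      cancel : ∀ x → x * x - + 1 * (x * x) ≡ + 0
      cancel = solve-∀
    half-factorials (suc m) r m+1+r≡h =
      ∣-cancelˡ p-prime (+ 1 + + r) (A - sgn (suc m) * H²) p∤r+1
        (subst (+ p ∣_) (sym step) (∣m∣n⇒∣m+n (∣n⇒∣m*n (+ 1 + (+ h + + m)) previous) (divides (sgn m * H²) refl)))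
      where
      p∤r+1 : ¬ + p ∣ + 1 + + r
      p∤r+1 = ∤-small (s≤s z≤n) (s≤s (ℕP.≤-trans (subst (suc r ℕ.≤_) m+1+r≡h (s≤s (ℕP.m≤n+m r m))) (ℕP.m≤m+n h h)))
      A = + ((h ℕ.+ suc m) !) * + (r !)
      X = + ((h ℕ.+ m) !)
      previous = half-factorials m (suc r) (trans (ℕP.+-suc m r) m+1+r≡h)
      h≡ : + h ≡ + 1 + + m + + r
      h≡ = sym (cong +_ m+1+r≡h)
      A≡ : A ≡ (+ 1 + (+ h + + m)) * X * + (r !)
      A≡ = trans (cong (λ z → + (z !) * + (r !)) (ℕP.+-suc h m)) (cong (_* + (r !)) (ℤP.pos-* (suc (h ℕ.+ m)) ((h ℕ.+ m) !)))
      step : (+ 1 + + r) * (A - sgn (suc m) * H²) ≡ (+ 1 + (+ h + + m)) * (X * + (suc r !) - sgn m * H²) + sgn m * H² * + p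
      step = begin
        (+ 1 + + r) * (A - - sgn m * H²)
          ≡⟨ cong (λ z → (+ 1 + + r) * (z - - sgn m * H²)) A≡ ⟩
        (+ 1 + + r) * ((+ 1 + (+ h + + m)) * X * + (r !) - - sgn m * H²)
          ≡⟨ cong (λ z → (+ 1 + + r) * ((+ 1 + (z + + m)) * X * + (r !) - - sgn m * H²)) h≡ ⟩
        (+ 1 + + r) * ((+ 1 + ((+ 1 + + m + + r) + + m)) * X * + (r !) - - sgn m * H²)
          ≡⟨ expand (+ r) (+ m) X (+ (r !)) (sgn m) H² ⟩
        (+ 1 + ((+ 1 + + m + + r) + + m)) * (X * ((+ 1 + + r) * + (r !)) - sgn m * H²) + sgn m * H² * (+ 1 + ((+ 1 + + m + + r) + (+ 1 + + m + + r)))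
          ≡⟨ cong (λ z → (+ 1 + (z + + m)) * (X * ((+ 1 + + r) * + (r !)) - sgn m * H²) + sgn m * H² * (+ 1 + (z + z))) (sym h≡) ⟩
        (+ 1 + (+ h + + m)) * (X * ((+ 1 + + r) * + (r !)) - sgn m * H²) + sgn m * H² * (+ 1 + (+ h + + h))
          ≡⟨ cong₂ (λ y z → (+ 1 + (+ h + + m)) * (X * y - sgn m * H²) + sgn m * H² * z) (sym (ℤP.pos-* (suc r) (r !))) refl ⟩
        (+ 1 + (+ h + + m)) * (X * + (suc r !) - sgn m * H²) + sgn m * H² * + p ∎
        where
        open ≡-Reasoning
        expand : ∀ r m x f s H → (+ 1 + r) * ((+ 1 + ((+ 1 + m + r) + m)) * x * f - - s * H)
               ≡ (+ 1 + ((+ 1 + m + r) + m)) * (x * ((+ 1 + r) * f) - s * H) + s * H * (+ 1 + ((+ 1 + m + r) + (+ 1 + m + r)))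
        expand = solve-∀

    -- If h is even, h! is a square root of -1 mod p: (2h)! ≡ (h!)² ≡ -1.
    square-root-of-−1 : sgn h ≡ + 1 → + p ∣ + (h !) * + (h !) - - + 1
    square-root-of-−1 h-even =
      subst (+ p ∣_) rearrange (∣m∣n⇒∣m+n wilson (∣m⇒∣-m (half-factorials h 0 (ℕP.+-identityʳ h))))
      where
      rearrange : + (n !) + + 1 + - (+ (n !) * + 1 - sgn h * H²) ≡ + (h !) * + (h !) - - + 1
      rearrange = trans (cong (λ z → + (n !) + + 1 + - (+ (n !) * + 1 - z * H²)) h-even) (cancel (+ (n !)) (+ (h !)))
        where
        cancel : ∀ N H → N + + 1 + - (N * + 1 - + 1 * (H * H)) ≡ H * H - - + 1
        cancel = solve-∀

    -- Conversely, if x² ≡ -1 then (-1)^h ≡ (x²)^h = x^(p-1) ≡ 1, so h is even.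
    square-root-of-−1⇒even : ∀ x → + p ∣ x * x - - + 1 → sgn h ≡ + 1
    square-root-of-−1⇒even x p∣x²+1 with sgn-cases h
    ... | inj₁ h-even = h-even
    ... | inj₂ h-odd = ⊥-elim (∤-small (s≤s z≤n) 2<p (∣m⇒∣-m p∣−2))
      where
      a = ℤ.∣ x ∣
      p∣a²+1 : + p ∣ + a * + a - - + 1
      p∣a²+1 = subst (λ z → + p ∣ z - - + 1) (square-abs x) p∣x²+1
        where
        square-abs : ∀ x → x * x ≡ + ℤ.∣ x ∣ * + ℤ.∣ x ∣
        square-abs (+ _) = refl
        square-abs ℤ.-[1+ _ ] = refl
      p∤a : ¬ + p ∣ + a
      p∤a p∣a = ∤-small (s≤s z≤n) (ℕP.<-trans (s≤s (s≤s z≤n)) 2<p)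
                  (subst (+ p ∣_) (cancel (+ a)) (∣m∣n⇒∣m+n p∣a²+1 (∣m⇒∣-m (∣n⇒∣m*n (+ a) p∣a))))
        where
        cancel : ∀ a → a * a - - + 1 + - (a * a) ≡ + 1
        cancel = solve-∀
      p∣a²ʰ-1 : + p ∣ (+ a * + a) ^ h - + 1
      p∣a²ʰ-1 = subst (λ z → + p ∣ z - + 1) (^-double (+ a) h) (fermat-unit a p∤a)
      p∣−2 : + p ∣ - + 2
      p∣−2 = subst (+ p ∣_) combine (∣m∣n⇒∣m+n p∣a²ʰ-1 (∣m⇒∣-m (∣-^-difference (+ p) (+ a * + a) (- + 1) h p∣a²+1)))
        where
        combine : (+ a * + a) ^ h - + 1 + - ((+ a * + a) ^ h - (- + 1) ^ h) ≡ - + 2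
        combine = trans (cong (λ z → (+ a * + a) ^ h - + 1 + - ((+ a * + a) ^ h - z)) (trans ([-1]^≡sgn h) h-odd))
                        (cancel ((+ a * + a) ^ h))
          where
          cancel : ∀ w → w - + 1 + - (w - - + 1) ≡ - + 2
          cancel = solve-∀

    legendre-−1 : ∀ ε → Legendre (- + 1) p ε → ε ≡ sgn h
    legendre-−1 ε (leg0 p∣1) with ℕ∣.∣1⇒≡1 p∣1
    ... | ()
    legendre-−1 ε (leg1 _ (x , p∣x²+1)) = sym (square-root-of-−1⇒even x (∣ᵤ⇒∣ p∣x²+1))
    legendre-−1 ε (leg-1 _ no-root) with sgn-cases h
    ... | inj₂ h-odd = sym h-odd
    ... | inj₁ h-even = ⊥-elim (no-root (+ (h !) , ∣⇒∣ᵤ (square-root-of-−1 h-even)))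

module PartI where
  open import Data.Nat as ℕ using (ℕ; zero; suc; _<_; _≤_; z≤n; s≤s; _!; _∸_)
  import Data.Nat.Properties as ℕP
  open import Data.Nat.Primality using (Prime; prime⇒nonZero; prime⇒nonTrivial)
  open import Data.Integer as ℤ using (ℤ; +_; _+_; _*_; -_; _-_; _^_)
  import Data.Integer.Properties as ℤP
  open import Data.Integer.Divisibility.Signed using (_∣_; divides; ∣m∣n⇒∣m+n; ∣m⇒∣-m; ∣n⇒∣m*n)
  open import Data.Integer.Tactic.RingSolver using (solve-∀)
  open import Relation.Nullary using (¬_)
  open import Relation.Binary.PropositionalEquality
  open Choose using (choose; choose-vanish; choose-factorial)
  open BinomialZ
  open Central
  open Sums
  open Sign
  open Primes

  hockey-stick : ∀ N k → Σ< N (λ n → C (n ℕ.+ k) (k ℕ.+ k)) ≡ C (N ℕ.+ k) (suc (k ℕ.+ k))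
  hockey-stick zero k = sym (cong +_ (choose-vanish k (suc (k ℕ.+ k)) (s≤s (ℕP.m≤m+n k k))))
  hockey-stick (suc N) k =
    trans (cong (_+ C (N ℕ.+ k) (k ℕ.+ k)) (hockey-stick N k))
          (trans (ℤP.+-comm (C (N ℕ.+ k) (suc (k ℕ.+ k))) (C (N ℕ.+ k) (k ℕ.+ k))) (sym (C-pascal (N ℕ.+ k) (k ℕ.+ k))))

  -- The summand obtained after exchanging the sums in Σ_{n<N} R n 1.
  T : ℕ → ℕ → ℤ
  T N k = c k * C (N ℕ.+ k) (suc (k ℕ.+ k))

  sum-R-exchange : ∀ N → Σ< N (λ n → Σ< (suc n) (λ k → c k * C (n ℕ.+ k) (k ℕ.+ k))) ≡ Σ< N (T N)
  sum-R-exchange N = begin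
    Σ< N (λ n → Σ< (suc n) (term n))
      ≡⟨ Σ<-cong N (λ n n<N → trans (sym (Σ<-pad (suc n) (N ∸ suc n) (term n) (term-vanish n)))
                                     (cong (λ z → Σ< z (term n)) (ℕP.m∸n+n≡m n<N))) ⟩
    Σ< N (λ n → Σ< N (term n))                          ≡⟨ Σ<-swap N N term ⟩
    Σ< N (λ k → Σ< N (λ n → term n k))
      ≡⟨ Σ<-cong N (λ k _ → trans (Σ<-* N (c k) (λ n → C (n ℕ.+ k) (k ℕ.+ k))) (cong (c k *_) (hockey-stick N k))) ⟩
    Σ< N (T N) ∎
    where
    open ≡-Reasoning
    term : ℕ → ℕ → ℤ
    term n k = c k * C (n ℕ.+ k) (k ℕ.+ k)
    term-vanish : ∀ n k → suc n ≤ k → term n k ≡ + 0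
    term-vanish n k n<k = trans (cong (λ z → c k * + z) (choose-vanish (n ℕ.+ k) (k ℕ.+ k) (ℕP.+-monoˡ-< k n<k))) (ℤP.*-zeroʳ (c k))

  Π : ℕ → ℕ → ℤ
  Π p zero = + 1
  Π p (suc k) = Π p k * (+ p * + p - (+ 1 + + k) * (+ 1 + + k))

  fac : ℕ → ℤ
  fac k = + (k !)

  fac-suc : ∀ k → fac (suc k) ≡ (+ 1 + + k) * fac k
  fac-suc k = ℤP.pos-* (suc k) (k !)

  -- (2k+1)! C(p+k,2k+1) = (p+k)(p+k-1)...(p-k) = p Π p k.
  oddFactorial*C : ∀ p k → + (suc (k ℕ.+ k) !) * C (p ℕ.+ k) (suc (k ℕ.+ k)) ≡ + p * Π p k
  oddFactorial*C p zero =
    trans (ℤP.*-identityˡ _) (trans (C-n-1 (p ℕ.+ 0)) (trans (cong +_ (ℕP.+-identityʳ p)) (sym (ℤP.*-identityʳ (+ p)))))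
  oddFactorial*C p (suc k) = trans (cong₂ (λ u v → + (suc u !) * C v (suc u)) (2[1+k]≡2+2k k) (ℕP.+-suc p k)) (begin
    + (suc (suc j) ℕ.* (suc j ℕ.* (j !))) * Y
      ≡⟨ cong (_* Y) (trans (ℤP.pos-* (suc (suc j)) (suc j ℕ.* (j !))) (cong (+ suc (suc j) *_) (ℤP.pos-* (suc j) (j !)))) ⟩
    + suc (suc j) * (+ suc j * G) * Y             ≡⟨ reorder (+ j) G Y ⟩
    G * ((+ 2 + + j) * (+ 1 + + j) * Y)           ≡⟨ cong (G *_) (C-absorb-twice a j) ⟩
    G * ((+ 1 + + a) * (+ a - + j) * X)           ≡⟨ reorder′ G X (+ 1 + + a) (+ a - + j) ⟩
    (G * X) * ((+ 1 + + a) * (+ a - + j))          ≡⟨ cong (_* ((+ 1 + + a) * (+ a - + j))) (oddFactorial*C p k) ⟩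
    + p * Π p k * ((+ 1 + (+ p + + k)) * ((+ p + + k) - (+ 1 + (+ k + + k))))
      ≡⟨ new-factor (+ p) (+ k) (Π p k) ⟩
    + p * (Π p k * (+ p * + p - (+ 1 + + k) * (+ 1 + + k))) ∎)
    where
    open ≡-Reasoning
    j = suc (k ℕ.+ k)
    a = p ℕ.+ k
    G = + (j !)
    X = C a j
    Y = C (suc a) (suc (suc j))
    reorder : ∀ j g y → (+ 2 + j) * ((+ 1 + j) * g) * y ≡ g * ((+ 2 + j) * (+ 1 + j) * y)
    reorder = solve-∀
    reorder′ : ∀ g x u v → g * (u * v * x) ≡ (g * x) * (u * v)
    reorder′ = solve-∀
    new-factor : ∀ p k q → p * q * ((+ 1 + (p + k)) * ((p + k) - (+ 1 + (k + k)))) ≡ p * (q * (p * p - (+ 1 + k) * (+ 1 + k)))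
    new-factor = solve-∀

  A : ℕ → ℤ
  A k = den k * (+ 1 + (+ k + + k))

  -- (2k-1)(2k+1) T p k (k!)² = p Π p k, since (2k-1) c k (k!)² = (2k)!.
  A*T*fac² : ∀ p k → A k * T p k * (fac k * fac k) ≡ + p * Π p k
  A*T*fac² p k = begin
    den k * (+ 1 + (+ k + + k)) * (c k * X) * (fac k * fac k)
      ≡⟨ reorder (den k) (+ 1 + (+ k + + k)) (c k) X (fac k * fac k) ⟩
    (+ 1 + (+ k + + k)) * ((den k * c k) * (fac k * fac k)) * X
      ≡⟨ cong (λ z → (+ 1 + (+ k + + k)) * (z * (fac k * fac k)) * X) (den*c k) ⟩
    (+ 1 + (+ k + + k)) * (C (k ℕ.+ k) k * (fac k * fac k)) * X
      ≡⟨ cong (λ z → (+ 1 + (+ k + + k)) * z * X) central-factorial ⟩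
    (+ 1 + (+ k + + k)) * + ((k ℕ.+ k) !) * X
      ≡⟨ cong (_* X) (sym (ℤP.pos-* (suc (k ℕ.+ k)) ((k ℕ.+ k) !))) ⟩
    + (suc (k ℕ.+ k) !) * X
      ≡⟨ oddFactorial*C p k ⟩
    + p * Π p k ∎
    where
    open ≡-Reasoning
    X = C (p ℕ.+ k) (suc (k ℕ.+ k))
    central-factorial : C (k ℕ.+ k) k * (fac k * fac k) ≡ + ((k ℕ.+ k) !)
    central-factorial = trans (cong (C (k ℕ.+ k) k *_) (sym (ℤP.pos-* (k !) (k !))))
                              (trans (sym (ℤP.pos-* (choose (k ℕ.+ k) k) _)) (cong +_ (choose-factorial k k)))
    reorder : ∀ o s t x f → o * s * (t * x) * f ≡ s * ((o * t) * f) * x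
    reorder = solve-∀

  -- Π p k ≡ Π_{j ≤ k} (-j²) = (-1)^k (k!)² (mod p²).
  Π-congruence : ∀ p k → (+ p) ^ 2 ∣ Π p k - sgn k * (fac k * fac k)
  Π-congruence p zero = divides (+ 0) refl
  Π-congruence p (suc k) =
    subst ((+ p) ^ 2 ∣_) (sym step)
      (∣m∣n⇒∣m+n (∣n⇒∣m*n (+ p * + p - (+ 1 + + k) * (+ 1 + + k)) (Π-congruence p k)) (divides (sgn k * (fac k * fac k)) refl))
    where
    step : Π p (suc k) - sgn (suc k) * (fac (suc k) * fac (suc k))
         ≡ (+ p * + p - (+ 1 + + k) * (+ 1 + + k)) * (Π p k - sgn k * (fac k * fac k)) + sgn k * (fac k * fac k) * (+ p) ^ 2
    step = trans (cong (λ z → Π p (suc k) - sgn (suc k) * (z * z)) (fac-suc k)) (expand (Π p k) (sgn k) (fac k) (+ p) (+ k))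
      where
      expand : ∀ P s f p k → P * (p * p - (+ 1 + k) * (+ 1 + k)) - - s * ((+ 1 + k) * f * ((+ 1 + k) * f))
             ≡ (p * p - (+ 1 + k) * (+ 1 + k)) * (P - s * (f * f)) + s * (f * f) * (p * (p * + 1))
      expand = solve-∀

  prime∤factorial : ∀ {p} → Prime p → ∀ k → k < p → ¬ + p ∣ fac k
  prime∤factorial {p} p-prime zero _ = ∤-small (s≤s z≤n) (ℕ.nonTrivial⇒n>1 p {{prime⇒nonTrivial p-prime}})
  prime∤factorial {p} p-prime (suc k) k<p rewrite fac-suc k =
    ∤-* p-prime (+ 1 + + k) (fac k) (∤-small (s≤s z≤n) k<p) (prime∤factorial p-prime k (ℕP.<-trans (ℕP.n<1+n k) k<p))

  Σ<-pairs : ∀ n (f : ℕ → ℤ) → Σ< (n ℕ.+ n) f ≡ Σ< n (λ i → f i + f (n ℕ.+ n ∸ suc i))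
  Σ<-pairs zero f = refl
  Σ<-pairs (suc m) f = begin
    Σ< (suc m ℕ.+ suc m) f
      ≡⟨ cong (λ z → Σ< (suc z) f) (ℕP.+-suc m m) ⟩
    Σ< (suc (m ℕ.+ m)) f + f (suc (m ℕ.+ m))
      ≡⟨ cong (_+ f (suc (m ℕ.+ m))) (Σ<-head (m ℕ.+ m) f) ⟩
    f 0 + Σ< (m ℕ.+ m) (λ k → f (suc k)) + f (suc (m ℕ.+ m))
      ≡⟨ cong (λ z → f 0 + z + f (suc (m ℕ.+ m))) (Σ<-pairs m (λ k → f (suc k))) ⟩
    f 0 + Σ< m (λ i → f (suc i) + f (suc (m ℕ.+ m ∸ suc i))) + f (suc (m ℕ.+ m))
      ≡⟨ cong₂ (λ x y → f 0 + x + f y) (Σ<-cong m (λ i i<m → cong (λ z → f (suc i) + f z) (partner i i<m))) (sym (ℕP.+-suc m m)) ⟩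
    f 0 + Σ< m (λ i → f (suc i) + f (suc m ℕ.+ suc m ∸ suc (suc i))) + f (m ℕ.+ suc m)
      ≡⟨ swap (f 0) (Σ< m (λ i → f (suc i) + f (suc m ℕ.+ suc m ∸ suc (suc i)))) (f (m ℕ.+ suc m)) ⟩
    f 0 + f (m ℕ.+ suc m) + Σ< m (λ i → f (suc i) + f (suc m ℕ.+ suc m ∸ suc (suc i)))
      ≡⟨ sym (Σ<-head m (λ i → f i + f (suc m ℕ.+ suc m ∸ suc i))) ⟩
    Σ< (suc m) (λ i → f i + f (suc m ℕ.+ suc m ∸ suc i)) ∎
    where
    open ≡-Reasoning
    swap : ∀ a b c → a + b + c ≡ a + c + b
    swap = solve-∀
    partner : ∀ i → i < m → suc (m ℕ.+ m ∸ suc i) ≡ suc m ℕ.+ suc m ∸ suc (suc i)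
    partner i i<m = trans (sym (ℕP.+-∸-assoc 1 (ℕP.≤-trans i<m (ℕP.m≤m+n m m))))
                          (cong (_∸ suc i) (sym (ℕP.+-suc m m)))

  -- If p ∤ a, a′ ≡ a (mod p), a t ≡ p s and a′ t′ ≡ -p s (mod p²), then
  -- t + t′ ≡ 0 (mod p²): first p ∣ t′, hence a′ t′ ≡ a t′ (mod p²).
  pair-congruence : ∀ {p} → Prime p → ∀ a a′ t t′ s c → a′ ≡ a + + p * c → ¬ + p ∣ a →
    (+ p) ^ 2 ∣ a * t - + p * s → (+ p) ^ 2 ∣ a′ * t′ + + p * s → (+ p) ^ 2 ∣ t + t′
  pair-congruence {p} p-prime a a′ t t′ s c a′≡ p∤a p²∣at-ps p²∣a′t′+ps@(divides q a′t′+ps≡) =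
    ∣-cancel p-prime 2 a (t + t′) p∤a
      (subst ((+ p) ^ 2 ∣_) (add a t t′ (+ p) s) (∣m∣n⇒∣m+n p²∣at-ps p²∣at′+ps))
    where
    p∣a′t′ : + p ∣ a′ * t′
    p∣a′t′ = divides (q * + p - s) (trans (isolate (a′ * t′) (+ p) s) (trans (cong (_- + p * s) a′t′+ps≡) (factor q (+ p) s)))
      where
      isolate : ∀ x p s → x ≡ x + p * s - p * s
      isolate = solve-∀
      factor : ∀ q p s → q * (p * (p * + 1)) - p * s ≡ (q * p - s) * p
      factor = solve-∀
    p∤a′ : ¬ + p ∣ a′
    p∤a′ (divides u a′≡u·p) = p∤a (divides (u - c) (trans (isolate a (+ p) c) (trans (cong (_- + p * c) (trans (sym a′≡) a′≡u·p)) (factor u (+ p) c))))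
      where
      isolate : ∀ a p c → a ≡ a + p * c - p * c
      isolate = solve-∀
      factor : ∀ u p c → u * p - p * c ≡ (u - c) * p
      factor = solve-∀
    p²∣at′+ps : (+ p) ^ 2 ∣ a * t′ + + p * s
    p²∣at′+ps with ∣-cancelˡ p-prime a′ t′ p∤a′ p∣a′t′
    ... | divides τ refl = subst ((+ p) ^ 2 ∣_) (shift a c τ (+ p) s)
            (∣m∣n⇒∣m+n (subst (λ z → (+ p) ^ 2 ∣ z * (τ * + p) + + p * s) a′≡ p²∣a′t′+ps) (∣m⇒∣-m (divides (c * τ) refl)))
      where
      shift : ∀ a c τ p s → (a + p * c) * (τ * p) + p * s + - ((c * τ) * (p * (p * + 1))) ≡ a * (τ * p) + p * s
      shift = solve-∀
    add : ∀ a t t′ p s → a * t - p * s + (a * t′ + p * s) ≡ a * (t + t′)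
    add = solve-∀

  module OddPrime (g : ℕ) (p-prime : Prime (suc (suc g ℕ.+ suc g))) where
    h = suc g
    p = suc (h ℕ.+ h)
    open FermatWilson.OddPrime g p-prime using (2<p)

    instance
      p≢0 : ℤ.NonZero (+ p)
      p≢0 = prime⇒nonZero p-prime

    private
      cancel-fac² : ∀ k → k < p → ∀ x → (+ p) ^ 2 ∣ (fac k * fac k) * x → (+ p) ^ 2 ∣ x
      cancel-fac² k k<p x p²∣ =
        ∣-cancel p-prime 2 (fac k) x (prime∤factorial p-prime k k<p)
          (∣-cancel p-prime 2 (fac k) (fac k * x) (prime∤factorial p-prime k k<p) (subst ((+ p) ^ 2 ∣_) (ℤP.*-assoc (fac k) (fac k) x) p²∣))

    -- A k T k ≡ p (-1)^k (mod p²) for k < p: multiply by (k!)² and use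
    -- `A*T*fac²` and `Π-congruence`.
    T-congruence : ∀ k → k < p → (+ p) ^ 2 ∣ A k * T p k - + p * sgn k
    T-congruence k k<p = cancel-fac² k k<p _ (subst ((+ p) ^ 2 ∣_) (sym scaled) (∣n⇒∣m*n (+ p) (Π-congruence p k)))
      where
      scaled : (fac k * fac k) * (A k * T p k - + p * sgn k) ≡ + p * (Π p k - sgn k * (fac k * fac k))
      scaled = trans (distrib (fac k * fac k) (A k * T p k) (+ p) (sgn k))
                     (trans (cong (λ z → z - + p * (sgn k * (fac k * fac k))) (A*T*fac² p k))
                            (factor (+ p) (Π p k) (sgn k * (fac k * fac k))))
        where
        distrib : ∀ f a p s → f * (a - p * s) ≡ a * f - p * (s * f)
        distrib = solve-∀
        factor : ∀ p a b → p * a - p * b ≡ p * (a - b)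
        factor = solve-∀

    -- When p ∣ A k the factor p can be cancelled once more: u T k ≡ (-1)^k.
    T-congruence-exact : ∀ k → k < p → ∀ u → A k ≡ u * + p → (+ p) ^ 2 ∣ u * T p k - sgn k
    T-congruence-exact k k<p u A≡up = cancel-fac² k k<p _ (subst ((+ p) ^ 2 ∣_) (sym scaled) (Π-congruence p k))
      where
      uT·fac² : u * T p k * (fac k * fac k) ≡ Π p k
      uT·fac² = ℤP.*-cancelˡ-≡ (+ p) _ _
        (trans (reorder (+ p) u (T p k) (fac k * fac k))
               (trans (cong (λ z → z * T p k * (fac k * fac k)) (sym A≡up)) (A*T*fac² p k)))
        where
        reorder : ∀ p u t f → p * (u * t * f) ≡ u * p * t * f
        reorder = solve-∀
      scaled : (fac k * fac k) * (u * T p k - sgn k) ≡ Π p k - sgn k * (fac k * fac k)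
      scaled = trans (distrib (fac k * fac k) u (T p k) (sgn k)) (cong (λ z → z - sgn k * (fac k * fac k)) uT·fac²)
        where
        distrib : ∀ f u t s → f * (u * t - s) ≡ u * t * f - s * f
        distrib = solve-∀

    -- Pairs k + k′ = p with 0 < k < h cancel mod p²: A k′ ≡ A k (mod p) and
    -- (-1)^k′ = -(-1)^k.
    pair-vanish : ∀ k k′ → k′ ℕ.+ k ≡ p → 0 < k → k ℕ.+ k < h ℕ.+ h → (+ p) ^ 2 ∣ T p k + T p k′
    pair-vanish k@(suc j) k′ k′+k≡p _ 2k<2h =
      pair-congruence p-prime (A k) (A k′) (T p k) (T p k′) (sgn k) (+ 4 * (+ k′ - + k)) A-shift p∤A
        (T-congruence k k<p) partner-congruence
      where
      k<p : k < p
      k<p = ℕP.<-trans (ℕP.m≤m+n (suc k) k) (s≤s 2k<2h)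
      k′<p : k′ < p
      k′<p = subst (k′ <_) k′+k≡p (ℕP.m<m+n k′ (s≤s z≤n))
      sgn-flip : sgn k′ ≡ - sgn k
      sgn-flip = begin
        sgn k′                          ≡⟨ sym (ℤP.*-identityʳ (sgn k′)) ⟩
        sgn k′ * + 1                    ≡⟨ cong (sgn k′ *_) (sym (sgn-square k)) ⟩
        sgn k′ * (sgn k * sgn k)        ≡⟨ sym (ℤP.*-assoc (sgn k′) (sgn k) (sgn k)) ⟩
        sgn k′ * sgn k * sgn k          ≡⟨ cong (_* sgn k) (trans (sym (sgn-+ k′ k)) (cong sgn k′+k≡p)) ⟩
        sgn p * sgn k                   ≡⟨ cong (λ z → - z * sgn k) (sgn-even h) ⟩
        - + 1 * sgn k                   ≡⟨ ℤP.-1*i≡-i (sgn k) ⟩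
        - sgn k ∎
        where open ≡-Reasoning
      A-shift : A k′ ≡ A k + + p * (+ 4 * (+ k′ - + k))
      A-shift = trans (difference (+ k′) (+ k)) (cong (λ z → A k + z * (+ 4 * (+ k′ - + k))) (cong +_ k′+k≡p))
        where
        difference : ∀ a b → (a + a - + 1) * (+ 1 + (a + a)) ≡ (b + b - + 1) * (+ 1 + (b + b)) + (a + b) * (+ 4 * (a - b))
        difference = solve-∀
      p∤A : ¬ + p ∣ A k
      p∤A = ∤-* p-prime (den k) (+ 1 + (+ k + + k))
              (subst (λ z → ¬ + p ∣ z) (odd (+ j)) (∤-small (s≤s z≤n) (s≤s (ℕP.<-trans (ℕP.+-monoʳ-< j (ℕP.n<1+n j)) (ℕP.<-trans (ℕP.n<1+n _) 2k<2h)))))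
              (∤-small (s≤s z≤n) (s≤s 2k<2h))
        where
        odd : ∀ j → + 1 + (j + j) ≡ (+ 1 + j) + (+ 1 + j) - + 1
        odd = solve-∀
      partner-congruence : (+ p) ^ 2 ∣ A k′ * T p k′ + + p * sgn k
      partner-congruence =
        subst ((+ p) ^ 2 ∣_) (trans (cong (λ z → A k′ * T p k′ - + p * z) sgn-flip) (minus-neg (A k′ * T p k′) (+ p) (sgn k)))
              (T-congruence k′ k′<p)
        where
        minus-neg : ∀ x p s → x - p * - s ≡ x + p * s
        minus-neg = solve-∀

    -- The middle pair: A h = (p-2) p and A (h+1) = (p+2) p, so
    -- (p-2) T h ≡ (-1)^h and (p+2) T (h+1) ≡ -(-1)^h (mod p²); combining with
    -- weights p+2 and p-2 gives -4 (T h + T (h+1) + (-1)^h) ≡ 0.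
    middle-pair : (+ p) ^ 2 ∣ T p h + T p (suc h) + sgn h
    middle-pair =
      ∣-cancel p-prime 2 (- + 4) _ p∤−4
        (subst ((+ p) ^ 2 ∣_) combine
          (∣m∣n⇒∣m+n (∣m∣n⇒∣m+n (∣n⇒∣m*n (+ p + + 2) lower) (∣n⇒∣m*n (+ p - + 2) upper))
                     (∣m⇒∣-m (divides (T p h + T p (suc h)) refl))))
      where
      p∤−4 : ¬ + p ∣ - + 4
      p∤−4 p∣−4 = ∤-* p-prime (+ 2) (+ 2) (∤-small (s≤s z≤n) 2<p) (∤-small (s≤s z≤n) 2<p)
                    (subst (+ p ∣_) (ℤP.neg-involutive (+ 4)) (∣m⇒∣-m p∣−4))
      lower : (+ p) ^ 2 ∣ (+ p - + 2) * T p h - sgn h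
      lower = T-congruence-exact h (s≤s (ℕP.m≤m+n h h)) (+ p - + 2) (factorise (+ h))
        where
        factorise : ∀ h → (h + h - + 1) * (+ 1 + (h + h)) ≡ (+ 1 + (h + h) - + 2) * (+ 1 + (h + h))
        factorise = solve-∀
      upper : (+ p) ^ 2 ∣ (+ p + + 2) * T p (suc h) + sgn h
      upper = subst (λ z → (+ p) ^ 2 ∣ (+ p + + 2) * T p (suc h) + z) (ℤP.neg-involutive (sgn h))
                (T-congruence-exact (suc h) (s≤s (s≤s (ℕP.m≤n+m (suc g) g))) (+ p + + 2) (factorise (+ h)))
        where
        factorise : ∀ h → ((+ 1 + h) + (+ 1 + h) - + 1) * (+ 1 + ((+ 1 + h) + (+ 1 + h))) ≡ (+ 1 + (h + h) + + 2) * (+ 1 + (h + h))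
        factorise = solve-∀
      combine : (+ p + + 2) * ((+ p - + 2) * T p h - sgn h) + (+ p - + 2) * ((+ p + + 2) * T p (suc h) + sgn h)
                + - ((T p h + T p (suc h)) * (+ p) ^ 2)
              ≡ - + 4 * (T p h + T p (suc h) + sgn h)
      combine = expand (+ p) (T p h) (T p (suc h)) (sgn h)
        where
        expand : ∀ p a b s → (p + + 2) * ((p - + 2) * a - s) + (p - + 2) * ((p + + 2) * b + s) + - ((a + b) * (p * (p * + 1)))
               ≡ - + 4 * (a + b + s)
        expand = solve-∀

    T-zero : T p 0 ≡ - + p
    T-zero = trans (cong (- + 1 *_) (trans (C-n-1 (p ℕ.+ 0)) (cong +_ (ℕP.+-identityʳ p)))) (ℤP.-1*i≡-i (+ p))

    -- Σ_{k<p} T p k ≡ -p - (-1)^h (mod p²): T 0 = -p, the pairs (k, p-k) with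
    -- 1 ≤ k < h vanish and the middle pair contributes -(-1)^h.
    main-congruence : (+ p) ^ 2 ∣ Σ< p (T p) + + p + sgn h
    main-congruence = subst ((+ p) ^ 2 ∣_) (sym regroup) (∣m∣n⇒∣m+n (∣-Σ< ((+ p) ^ 2) g pairs pairs-vanish) middle-pair)
      where
      pairs : ℕ → ℤ
      pairs i = T p (suc i) + T p (suc (h ℕ.+ h ∸ suc i))
      pairs-vanish : ∀ i → i < g → (+ p) ^ 2 ∣ pairs i
      pairs-vanish i i<g =
        pair-vanish (suc i) (suc (h ℕ.+ h ∸ suc i)) (cong suc (ℕP.m∸n+n≡m i<2h)) (s≤s z≤n) (ℕP.+-mono-< (s≤s i<g) (s≤s i<g))
        where
        i<2h : suc i ≤ h ℕ.+ h
        i<2h = ℕP.≤-trans (s≤s (ℕP.<⇒≤ i<g)) (ℕP.m≤m+n h h)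
      regroup : Σ< p (T p) + + p + sgn h ≡ Σ< g pairs + (T p h + T p (suc h) + sgn h)
      regroup = begin
        Σ< p (T p) + + p + sgn h
          ≡⟨ cong (λ z → z + + p + sgn h) (trans (Σ<-head (h ℕ.+ h) (T p)) (cong (λ z → T p 0 + z) (Σ<-pairs h (λ k → T p (suc k))))) ⟩
        T p 0 + (Σ< g pairs + (T p h + T p (suc (h ℕ.+ h ∸ suc g)))) + + p + sgn h
          ≡⟨ cong₂ (λ x y → x + (Σ< g pairs + (T p h + T p y)) + + p + sgn h) T-zero (cong suc (ℕP.m+n∸m≡n h h)) ⟩
        - + p + (Σ< g pairs + (T p h + T p (suc h))) + + p + sgn h
          ≡⟨ cancel (+ p) (Σ< g pairs) (T p h) (T p (suc h)) (sgn h) ⟩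
        Σ< g pairs + (T p h + T p (suc h) + sgn h) ∎
        where
        open ≡-Reasoning
        cancel : ∀ p a x y s → - p + (a + (x + y)) + p + s ≡ a + (x + y + s)
        cancel = solve-∀

module TheoremParts where
  open import Data.Nat using (zero; z≤n; s≤s)
  import Data.Nat.Properties as ℕP
  import Data.Nat.Primality as Primality
  import Data.Nat.Divisibility as ℕ∣
  open import Data.Integer using (_+_; _*_; -_; _-_; _^_)
  import Data.Integer.Properties as ℤP
  open import Data.Integer.Divisibility.Signed using (_∣_)
  open import Data.Integer.Tactic.RingSolver using (solve-∀)
  open import Data.Sum using (_⊎_; inj₁; inj₂)
  open import Data.Empty using (⊥-elim)
  open import Relation.Binary.PropositionalEquality
  open Embedding
  open BinomialZ
  open Central
  open Sums
  open Sign
  open RationalForms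
  open PartIIa
  open PartIIb
  open PartI using (T; sum-R-exchange; module OddPrime)

  even-or-odd : ∀ n → ∃ (λ t → n ≡ t ℕ.+ t) ⊎ ∃ (λ t → n ≡ suc (t ℕ.+ t))
  even-or-odd zero = inj₁ (0 , refl)
  even-or-odd (suc n) with even-or-odd n
  ... | inj₁ (t , n≡2t) = inj₂ (t , cong suc n≡2t)
  ... | inj₂ (t , n≡2t+1) = inj₁ (suc t , cong suc (trans n≡2t+1 (sym (ℕP.+-suc t t))))

  part-i-odd : ∀ g (p-prime : Prime (suc (suc g ℕ.+ suc g))) ε → Legendre (- + 1) (suc (suc g ℕ.+ suc g)) ε →
    ∃ λ (m : ℤ) → sumTo (suc g ℕ.+ suc g) (λ k → R k ℚ.1ℚ)
                    ≡ ((- + suc (suc g ℕ.+ suc g) - ε + (+ suc (suc g ℕ.+ suc g) * + suc (suc g ℕ.+ suc g)) * m) ℚ./ 1)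
  part-i-odd g p-prime ε legendre = quotient , (begin
    sumTo (h ℕ.+ h) (λ k → R k ℚ.1ℚ)
      ≡⟨ sumTo-ι (h ℕ.+ h) (λ k → R k ℚ.1ℚ) (λ n → Σ< (suc n) (λ k → c k * C (n ℕ.+ k) (k ℕ.+ k))) R-at-1 ⟩
    ι (Σ< p (λ n → Σ< (suc n) (λ k → c k * C (n ℕ.+ k) (k ℕ.+ k))))
      ≡⟨ cong ι (sum-R-exchange p) ⟩
    ι (Σ< p (T p))
      ≡⟨ cong ι (solve-for (Σ< p (T p)) (+ p) ε quotient (subst (λ e → Σ< p (T p) + + p + e ≡ quotient * (+ p) ^ 2) (sym ε≡sgn) equality)) ⟩
    ι (- + p - ε + + p * + p * quotient) ∎)
    where
    open ≡-Reasoning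
    h = suc g
    p = suc (h ℕ.+ h)
    ε≡sgn : ε ≡ sgn h
    ε≡sgn = FermatWilson.OddPrime.legendre-−1 g p-prime ε legendre
    open _∣_ (OddPrime.main-congruence g p-prime)
    solve-for : ∀ S P s q → S + P + s ≡ q * (P * (P * + 1)) → S ≡ - P - s + P * P * q
    solve-for S P s q eq = trans (isolate S P s) (trans (cong (λ z → z - P - s) eq) (rearrange q P s))
      where
      isolate : ∀ S P s → S ≡ S + P + s - P - s
      isolate = solve-∀
      rearrange : ∀ q P s → q * (P * (P * + 1)) - P - s ≡ - P - s + P * P * q
      rearrange = solve-∀

  -- Part (i): an odd prime p is 2h+1 with h ≥ 1.
  part-i : (p : ℕ) → Prime p → 2 < p → (ε : ℤ) → Legendre (- + 1) p ε →
    ∃ λ (m : ℤ) → sumTo (p ∸ 1) (λ k → R k ℚ.1ℚ) ≡ ((- + p - ε + (+ p * + p) * m) ℚ./ 1)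
  part-i p p-prime 2<p ε legendre with even-or-odd p
  ... | inj₁ (t , refl) = ⊥-elim (Primality.Prime.notComposite p-prime
          (ℕ∣.hasNonTrivialDivisor {divisor = 2} 2<p (ℕ∣.divides t (trans (cong (t ℕ.+_) (sym (ℕP.+-identityʳ t))) (ℕP.*-comm 2 t)))))
  ... | inj₂ (zero , refl) = ⊥-elim (ℕP.<-irrefl refl (ℕP.<-trans (s≤s (s≤s z≤n)) 2<p))
  ... | inj₂ (suc g , refl) = part-i-odd g p-prime ε legendre

  R-at-−1-value : ∀ n → R n (ℚ.- ℚ.1ℚ) ≡ ((- + (2 ℕ.* n ℕ.+ 1)) ℚ./ 1)
  R-at-−1-value n = trans (R-at-−1 n) (cong ι (trans (altSum-value n) (cong -_ (trans (reorder (+ n)) (cong (_+ + 1) (sym (ℤP.pos-* 2 n)))))))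
    where
    reorder : ∀ n → + 1 + (n + n) ≡ + 2 * n + + 1
    reorder = solve-∀

  binomial-sum-value : ∀ m → sumTo (suc m) (λ k → divOdd (binomℤ (+ suc m) k ℚ.* binomℤ (- + suc m) k) k) ≡ ((- + (2 ℕ.* suc m)) ℚ./ 1)
  binomial-sum-value m =
    trans (sumTo-ι (suc m) _ (λ k → sgn k * pairTerm m k) term-ι)
          (cong ι (trans (pairSum-value m) (cong -_ (sym (ℤP.pos-* 2 (suc m))))))
    where
    term-ι : ∀ k → divOdd (binomℤ (+ suc m) k ℚ.* binomℤ (- + suc m) k) k ≡ ι (sgn k * pairTerm m k)
    term-ι k = trans (cong (λ q → divOdd q k) (trans (cong₂ ℚ._*_ (binomℤ-pos (suc m) k) (binomℤ-neg m k))
                                                     (trans (ι-* (C (suc m) k) (sgn k * C (m ℕ.+ k) k)) (cong ι product))))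
                     (divOdd-ι k (sgn k * pairTerm m k))
      where
      product : C (suc m) k * (sgn k * C (m ℕ.+ k) k) ≡ den k * (sgn k * pairTerm m k)
      product = trans (swap (C (suc m) k) (sgn k) (C (m ℕ.+ k) k))
                      (trans (cong (sgn k *_) (sym (den*pairTerm m k))) (swap (sgn k) (den k) (pairTerm m k)))
        where
        swap : ∀ x s y → x * (s * y) ≡ s * (x * y)
        swap = solve-∀

open TheoremParts

theorem1p3 : ((p : ℕ) → Prime p → 2 < p → (ε : ℤ) → Legendre (ℤ.- + 1) p ε →
    ∃ λ (m : ℤ) →
      sumTo (p ∸ 1) (λ k → R k ℚ.1ℚ)
        ≡ ((ℤ.- + p ℤ.- ε ℤ.+ (+ p ℤ.* + p) ℤ.* m) ℚ./ 1))
  ×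
  ((n : ℕ) → 0 < n →
    (R n (ℚ.- ℚ.1ℚ) ≡ ((ℤ.- + (2 ℕ.* n ℕ.+ 1)) ℚ./ 1))
    × (sumTo n (λ k → divOdd (binomℤ (+ n) k ℚ.* binomℤ (ℤ.- + n) k) k)
        ≡ ((ℤ.- + (2 ℕ.* n)) ℚ./ 1)))
theorem1p3 = part-i , λ { (suc m) _ → R-at-−1-value (suc m) , binomial-sum-value m }
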